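{- The theory $V^0$ proves the transitivity of graph homomorphism: for all graphs $\mathcal{G}=(V_\mathcal{G},E_\mathcal{G})$, $\mathcal{H}=(V_\mathcal{H},E_\mathcal{H})$, $\mathcal{S}=(V_\mathcal{S},E_\mathcal{S})$, $$V^0\vdash \forall \mathcal{G},\mathcal{H},\mathcal{S}\,\big(HOM(\mathcal{G},\mathcal{H})\wedge HOM(\mathcal{H},\mathcal{S})\to HOM(\mathcal{G},\mathcal{S})\big).$$
   Context: $V^0$ is the two-sorted first-order theory over the vocabulary $\mathcal{L}^2_{PA}=\{0,1,+,\cdot,|\cdot|;=_1,=_2,\leq,\in\}$, with number variables (ranging over $\mathbb{N}$) and string (finite set) variables $X,Y,Z,\dots$ ranging over finite subsets of $\mathbb{N}$; $|X|$ denotes the least upper bound of $X$ (its length) and $X(t)$ abbreviates $t\in X$. $V^0$ is axiomatized by the standard basic axioms 2-BASIC for these symbols and the comprehension scheme $\Sigma^B_0$-COMP: $\exists X\leq y\,\forall z<y\,(X(z)\leftrightarrow\varphi(z))$ for every formula $\varphi$ whose only quantifiers are bounded number quantifiers ($X$ not free in $\varphi$). A bounded string quantifier $\exists X\leq t$ means $\exists X(|X|\leq t\wedge\dots)$. The pairing function is the term $\langle x,y\rangle=(x+y)(x+y+1)+2y$, and $E(i,j)$ abbreviates $E(\langle i,j\rangle)$. A graph is a pair of strings $\mathcal{G}=(V_\mathcal{G},E_\mathcal{G})$ with $|V_\mathcal{G}|=n$ satisfying $GRAPH(V_\mathcal{G},E_\mathcal{G}):\ \forall i<n\,V_\mathcal{G}(i)\wedge\forall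 i<j<n\,(E_\mathcal{G}(i,j)\leftrightarrow E_\mathcal{G}(j,i))\wedge\forall i<n\,\neg E_\mathcal{G}(i,i)$; quantification over graphs means quantification over such pairs of strings. $MAP(n,m,Z):\ \forall i<n\,\exists j<m\,Z(\langle i,j\rangle)\wedge\forall i<n\,\forall j_1,j_2<m\,(Z(\langle i,j_1\rangle)\wedge Z(\langle i,j_2\rangle)\to j_1=j_2)$. For graphs $\mathcal{G},\mathcal{H}$ with $|V_\mathcal{G}|=n$, $|V_\mathcal{H}|=m$: $HOM(\mathcal{G},\mathcal{H}):\ \exists Z\leq\langle n-1,m-1\rangle\,\big(MAP(n,m,Z)\wedge\forall i_1,i_2<n\,\forall j_1,j_2<m\,(E_\mathcal{G}(i_1,i_2)\wedge Z(\langle i_1,j_1\rangle)\wedge Z(\langle i_2,j_2\rangle)\to E_\mathcal{H}(j_1,j_2))\big)$. -}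

module Defs where

-- Variables are de Bruijn indices: Tm n s / Fm n s have n number variables
-- and s string variables in scope.

open import Data.Nat using (ℕ; zero; suc)
open import Data.Fin using (Fin; zero; suc; #_)
open import Function using (id; _∘_)

infixl 7 _`·_
infixl 6 _`+_
infix  4 _≐_ _≐ₛ_ _≤'_ _<'_ _∈'_
infixr 3 _∧'_
infixr 2 _∨'_
infixr 1 _⇒_ _⇔_

-- number terms (string terms are only string variables)
data Tm (n s : ℕ) : Set where
  var  : Fin n → Tm n s
  `0   : Tm n s
  `1   : Tm n s
  _`+_ : Tm n s → Tm n s → Tm n s
  _`·_ : Tm n s → Tm n s → Tm n s
  ∣_∣  : Fin s → Tm n s

data Fm (n s : ℕ) : Set where
  _≐_   : Tm n s → Tm n s → Fm n s
  _≐ₛ_  : Fin s → Fin s → Fm n s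
  _≤'_  : Tm n s → Tm n s → Fm n s
  _∈'_  : Tm n s → Fin s → Fm n s
  ⊥'    : Fm n s
  _⇒_   : Fm n s → Fm n s → Fm n s
  _∧'_  : Fm n s → Fm n s → Fm n s
  _∨'_  : Fm n s → Fm n s → Fm n s
  ∀N    : Fm (suc n) s → Fm n s
  ∃N    : Fm (suc n) s → Fm n s
  ∀S    : Fm n (suc s) → Fm n s
  ∃S    : Fm n (suc s) → Fm n s

¬'_ : ∀ {n s} → Fm n s → Fm n s
¬' φ = φ ⇒ ⊥'

_⇔_ : ∀ {n s} → Fm n s → Fm n s → Fm n s
φ ⇔ ψ = (φ ⇒ ψ) ∧' (ψ ⇒ φ)

_<'_ : ∀ {n s} → Tm n s → Tm n s → Fm n s
t <' u = (t ≤' u) ∧' ¬' (t ≐ u)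

renTm : ∀ {n n' s s'} → (Fin n → Fin n') → (Fin s → Fin s') → Tm n s → Tm n' s'
renTm ρ σ (var i)  = var (ρ i)
renTm ρ σ `0       = `0
renTm ρ σ `1       = `1
renTm ρ σ (t `+ u) = renTm ρ σ t `+ renTm ρ σ u
renTm ρ σ (t `· u) = renTm ρ σ t `· renTm ρ σ u
renTm ρ σ ∣ X ∣    = ∣ σ X ∣

substTm : ∀ {n n' s s'} → (Fin n → Tm n' s') → (Fin s → Fin s') → Tm n s → Tm n' s'
substTm f g (var i)  = f i
substTm f g `0       = `0
substTm f g `1       = `1
substTm f g (t `+ u) = substTm f g t `+ substTm f g u
substTm f g (t `· u) = substTm f g t `· substTm f g u
substTm f g ∣ X ∣    = ∣ g X ∣

liftN : ∀ {n n' s'} → (Fin n → Tm n' s') → Fin (suc n) → Tm (suc n') s'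
liftN f zero    = var zero
liftN f (suc i) = renTm suc id (f i)

liftNS : ∀ {n n' s'} → (Fin n → Tm n' s') → Fin n → Tm n' (suc s')
liftNS f i = renTm id suc (f i)

liftS : ∀ {s s'} → (Fin s → Fin s') → Fin (suc s) → Fin (suc s')
liftS g zero    = zero
liftS g (suc i) = suc (g i)

sub : ∀ {n n' s s'} → (Fin n → Tm n' s') → (Fin s → Fin s') → Fm n s → Fm n' s'
sub f g (t ≐ u)  = substTm f g t ≐ substTm f g u
sub f g (X ≐ₛ Y) = g X ≐ₛ g Y
sub f g (t ≤' u) = substTm f g t ≤' substTm f g u
sub f g (t ∈' X) = substTm f g t ∈' g X
sub f g ⊥'       = ⊥'
sub f g (φ ⇒ ψ)  = sub f g φ ⇒ sub f g ψ
sub f g (φ ∧' ψ) = sub f g φ ∧' sub f g ψ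
sub f g (φ ∨' ψ) = sub f g φ ∨' sub f g ψ
sub f g (∀N φ)   = ∀N (sub (liftN f) g φ)
sub f g (∃N φ)   = ∃N (sub (liftN f) g φ)
sub f g (∀S φ)   = ∀S (sub (liftNS f) (liftS g) φ)
sub f g (∃S φ)   = ∃S (sub (liftNS f) (liftS g) φ)

wkTmN : ∀ {n s} → Tm n s → Tm (suc n) s
wkTmN = renTm suc id

wkN : ∀ {n s} → Fm n s → Fm (suc n) s
wkN = sub (var ∘ suc) id

wkS : ∀ {n s} → Fm n s → Fm n (suc s)
wkS = sub var suc

instN : ∀ {n s} → Fm (suc n) s → Tm n s → Fm n s
instN φ t = sub (λ { zero → t ; (suc i) → var i }) id φ

instS : ∀ {n s} → Fm n (suc s) → Fin s → Fm n s
instS φ X = sub var (λ { zero → X ; (suc i) → i }) φ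

embed : ∀ {n s} → Fm 0 0 → Fm n s
embed = sub (λ ()) (λ ())

closeN : ∀ {n s} → Fm n s → Fm 0 s
closeN {zero}  φ = φ
closeN {suc n} φ = closeN (∀N φ)

closeS : ∀ {s} → Fm 0 s → Fm 0 0
closeS {zero}  φ = φ
closeS {suc s} φ = closeS (∀S φ)

close : ∀ {n s} → Fm n s → Fm 0 0
close = closeS ∘ closeN

infix 0 _⊢_

data _⊢_ (T : Fm 0 0 → Set) : ∀ {n s} → Fm n s → Set where
  ax    : ∀ {n s} {φ : Fm 0 0} → T φ → T ⊢ embed {n} {s} φ
  mp    : ∀ {n s} {φ ψ : Fm n s} → T ⊢ φ ⇒ ψ → T ⊢ φ → T ⊢ ψ
  K     : ∀ {n s} {φ ψ : Fm n s} → T ⊢ φ ⇒ ψ ⇒ φ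
  S     : ∀ {n s} {φ ψ χ : Fm n s} → T ⊢ (φ ⇒ ψ ⇒ χ) ⇒ (φ ⇒ ψ) ⇒ φ ⇒ χ
  ∧I    : ∀ {n s} {φ ψ : Fm n s} → T ⊢ φ ⇒ ψ ⇒ φ ∧' ψ
  ∧E₁   : ∀ {n s} {φ ψ : Fm n s} → T ⊢ φ ∧' ψ ⇒ φ
  ∧E₂   : ∀ {n s} {φ ψ : Fm n s} → T ⊢ φ ∧' ψ ⇒ ψ
  ∨I₁   : ∀ {n s} {φ ψ : Fm n s} → T ⊢ φ ⇒ φ ∨' ψ
  ∨I₂   : ∀ {n s} {φ ψ : Fm n s} → T ⊢ ψ ⇒ φ ∨' ψ
  ∨E    : ∀ {n s} {φ ψ χ : Fm n s} → T ⊢ (φ ⇒ χ) ⇒ (ψ ⇒ χ) ⇒ φ ∨' ψ ⇒ χ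
  ⊥E    : ∀ {n s} {φ : Fm n s} → T ⊢ ⊥' ⇒ φ
  dne   : ∀ {n s} {φ : Fm n s} → T ⊢ ¬' ¬' φ ⇒ φ
  ∀Ne   : ∀ {n s} {φ : Fm (suc n) s} (t : Tm n s) → T ⊢ ∀N φ ⇒ instN φ t
  ∃Ni   : ∀ {n s} {φ : Fm (suc n) s} (t : Tm n s) → T ⊢ instN φ t ⇒ ∃N φ
  ∀Nr   : ∀ {n s} {ψ : Fm n s} {φ : Fm (suc n) s} → T ⊢ wkN ψ ⇒ φ → T ⊢ ψ ⇒ ∀N φ
  ∃Nr   : ∀ {n s} {ψ : Fm n s} {φ : Fm (suc n) s} → T ⊢ φ ⇒ wkN ψ → T ⊢ ∃N φ ⇒ ψ
  ∀Se   : ∀ {n s} {φ : Fm n (suc s)} (X : Fin s) → T ⊢ ∀S φ ⇒ instS φ X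
  ∃Si   : ∀ {n s} {φ : Fm n (suc s)} (X : Fin s) → T ⊢ instS φ X ⇒ ∃S φ
  ∀Sr   : ∀ {n s} {ψ : Fm n s} {φ : Fm n (suc s)} → T ⊢ wkS ψ ⇒ φ → T ⊢ ψ ⇒ ∀S φ
  ∃Sr   : ∀ {n s} {ψ : Fm n s} {φ : Fm n (suc s)} → T ⊢ φ ⇒ wkS ψ → T ⊢ ∃S φ ⇒ ψ
  ≐refl  : ∀ {n s} (t : Tm n s) → T ⊢ t ≐ t
  ≐subst : ∀ {n s} (φ : Fm (suc n) s) (t u : Tm n s) → T ⊢ t ≐ u ⇒ instN φ t ⇒ instN φ u
  ≐ₛrefl  : ∀ {n s} (X : Fin s) → T ⊢ (_≐ₛ_ {n} X X)
  ≐ₛsubst : ∀ {n s} (φ : Fm n (suc s)) (X Y : Fin s) → T ⊢ X ≐ₛ Y ⇒ instS φ X ⇒ instS φ Y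

private
  x0 : ∀ {n s} → Tm (suc n) s
  x0 = var zero
  x1 : ∀ {n s} → Tm (suc (suc n)) s
  x1 = var (suc zero)

-- 2-BASIC (Cook–Nguyen), as open formulas; the axioms are their closures
B1 B2 B3 B4 B5 B6 B7 B8 B9 B10 B11 B12 : Fm 2 0
B1  = ¬' (x0 `+ `1 ≐ `0)
B2  = (x0 `+ `1 ≐ x1 `+ `1) ⇒ (x0 ≐ x1)
B3  = x0 `+ `0 ≐ x0
B4  = x0 `+ (x1 `+ `1) ≐ (x0 `+ x1) `+ `1
B5  = x0 `· `0 ≐ `0
B6  = x0 `· (x1 `+ `1) ≐ (x0 `· x1) `+ x0
B7  = ((x0 ≤' x1) ∧' (x1 ≤' x0)) ⇒ (x0 ≐ x1)
B8  = x0 ≤' x0 `+ x1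
B9  = `0 ≤' x0
B10 = (x0 ≤' x1) ∨' (x1 ≤' x0)
B11 = (x0 ≤' x1) ⇔ (x0 <' x1 `+ `1)
B12 = ¬' (x0 ≐ `0) ⇒ ∃N ((x0 ≤' x1) ∧' (x0 `+ `1 ≐ x1))   -- ∃y≤x (y+1=x)

L1 L2 : Fm 1 1
L1 = (x0 ∈' zero) ⇒ (x0 <' ∣ zero ∣)
L2 = (x0 `+ `1 ≐ ∣ zero ∣) ⇒ (x0 ∈' zero)

SE : Fm 0 2
SE = ((∣ # 0 ∣ ≐ ∣ # 1 ∣) ∧' ∀N ((x0 <' ∣ # 0 ∣) ⇒ ((x0 ∈' # 0) ⇔ (x0 ∈' # 1))))
     ⇒ (# 0 ≐ₛ # 1)

data IsΣB0 : ∀ {n s} → Fm n s → Set where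
  eq   : ∀ {n s} (t u : Tm n s) → IsΣB0 (t ≐ u)
  eqS  : ∀ {n s} (X Y : Fin s) → IsΣB0 {n} (X ≐ₛ Y)
  le   : ∀ {n s} (t u : Tm n s) → IsΣB0 (t ≤' u)
  mem  : ∀ {n s} (t : Tm n s) (X : Fin s) → IsΣB0 (t ∈' X)
  bot  : ∀ {n s} → IsΣB0 {n} {s} ⊥'
  imp  : ∀ {n s} {φ ψ : Fm n s} → IsΣB0 φ → IsΣB0 ψ → IsΣB0 (φ ⇒ ψ)
  and  : ∀ {n s} {φ ψ : Fm n s} → IsΣB0 φ → IsΣB0 ψ → IsΣB0 (φ ∧' ψ)
  or   : ∀ {n s} {φ ψ : Fm n s} → IsΣB0 φ → IsΣB0 ψ → IsΣB0 (φ ∨' ψ)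
  all≤ : ∀ {n s} (t : Tm n s) {φ : Fm (suc n) s} → IsΣB0 φ → IsΣB0 (∀N ((x0 ≤' wkTmN t) ⇒ φ))
  ex≤  : ∀ {n s} (t : Tm n s) {φ : Fm (suc n) s} → IsΣB0 φ → IsΣB0 (∃N ((x0 ≤' wkTmN t) ∧' φ))
  all< : ∀ {n s} (t : Tm n s) {φ : Fm (suc n) s} → IsΣB0 φ → IsΣB0 (∀N ((x0 <' wkTmN t) ⇒ φ))
  ex<  : ∀ {n s} (t : Tm n s) {φ : Fm (suc n) s} → IsΣB0 φ → IsΣB0 (∃N ((x0 <' wkTmN t) ∧' φ))

-- Sigma^B_0-COMP instance:  ∃X≤y ∀z<y (X(z) ↔ φ(z)),  φ : Fm (suc n) s with z = variable 0,
-- y a number variable (which may occur in φ), X the fresh string variable.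
COMP : ∀ {n s} → Fm (suc n) s → Fin n → Fm n s
COMP φ y = ∃S ((∣ zero ∣ ≤' var y) ∧'
               ∀N ((x0 <' var (suc y)) ⇒ ((x0 ∈' zero) ⇔ wkS φ)))

data V0 : Fm 0 0 → Set where
  b1 : V0 (close B1)
  b2 : V0 (close B2)
  b3 : V0 (close B3)
  b4 : V0 (close B4)
  b5 : V0 (close B5)
  b6 : V0 (close B6)
  b7 : V0 (close B7)
  b8 : V0 (close B8)
  b9 : V0 (close B9)
  b10 : V0 (close B10)
  b11 : V0 (close B11)
  b12 : V0 (close B12)
  l1 : V0 (close L1)
  l2 : V0 (close L2)
  se : V0 (close SE)
  comp : ∀ {n s} (φ : Fm (suc n) s) → IsΣB0 φ → (y : Fin n) → V0 (close (COMP φ y))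

⟨_,_⟩ : ∀ {n s} → Tm n s → Tm n s → Tm n s
⟨ x , y ⟩ = ((x `+ y) `· ((x `+ y) `+ `1)) `+ ((`1 `+ `1) `· y)

Ed : ∀ {n s} → Fin s → Tm n s → Tm n s → Fm n s
Ed E i j = ⟨ i , j ⟩ ∈' E

-- GRAPH(V,E) with V = string 0, E = string 1, n = |V|
GRAPH₀ : Fm 0 2
GRAPH₀ =
  ∀N ((x0 <' ∣ # 0 ∣) ⇒ (x0 ∈' # 0)) ∧'
  ∀N ((x0 <' ∣ # 0 ∣) ⇒ ∀N ((x0 <' x1) ⇒ (Ed (# 1) x0 x1 ⇔ Ed (# 1) x1 x0))) ∧'
  ∀N ((x0 <' ∣ # 0 ∣) ⇒ ¬' Ed (# 1) x0 x0)

GRAPH : ∀ {n s} → Fin s → Fin s → Fm n s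
GRAPH V E = sub (λ ()) (λ { zero → V ; (suc zero) → E }) GRAPH₀

-- MAP(n,m,Z) with n = number var 0, m = number var 1, Z = string 0
MAP₀ : Fm 2 1
MAP₀ =
  ∀N ((x0 <' var (# 1)) ⇒ ∃N ((x0 <' var (# 3)) ∧' (⟨ x1 , x0 ⟩ ∈' zero))) ∧'
  ∀N ((x0 <' var (# 1)) ⇒ ∀N ((x0 <' var (# 3)) ⇒ ∀N ((x0 <' var (# 4)) ⇒
     (((⟨ var (# 2) , x1 ⟩ ∈' zero) ∧' (⟨ var (# 2) , x0 ⟩ ∈' zero)) ⇒ (x1 ≐ x0)))))

MAP : ∀ {n s} → Tm n s → Tm n s → Fin s → Fm n s
MAP t u Z = sub (λ { zero → t ; (suc zero) → u }) (λ { zero → Z }) MAP₀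

-- HOM(G,H) with V_G, E_G, V_H, E_H = strings 0,1,2,3.
-- Inside ∃Z: Z = 0, V_G = 1, E_G = 2, V_H = 3, E_H = 4; n = |V_G|, m = |V_H|.
HOM₀ : Fm 0 4
HOM₀ = ∃S (
  (∣ zero ∣ ≤' ⟨ ∣ # 1 ∣ , ∣ # 3 ∣ ⟩) ∧'
  MAP ∣ # 1 ∣ ∣ # 3 ∣ zero ∧'
  ∀N ((x0 <' ∣ # 1 ∣) ⇒ ∀N ((x0 <' ∣ # 1 ∣) ⇒
  ∀N ((x0 <' ∣ # 3 ∣) ⇒ ∀N ((x0 <' ∣ # 3 ∣) ⇒
    ((Ed (# 2) (var (# 3)) (var (# 2)) ∧'
      (⟨ var (# 3) , var (# 1) ⟩ ∈' zero) ∧' (⟨ var (# 2) , var (# 0) ⟩ ∈' zero))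
     ⇒ Ed (# 4) (var (# 1)) (var (# 0))))))))

HOM : ∀ {n s} → Fin s → Fin s → Fin s → Fin s → Fm n s
HOM VG EG VH EH =
  sub (λ ()) (λ { zero → VG ; (suc zero) → EG ; (suc (suc zero)) → VH ; (suc (suc (suc zero))) → EH }) HOM₀

-- ∀G,H,S (HOM(G,H) ∧ HOM(H,S) → HOM(G,S)), quantification over graphs being
-- ∀V ∀E (GRAPH(V,E) → …). Strings: V_G=0, E_G=1, V_H=2, E_H=3, V_S=4, E_S=5.
HOM-trans : Fm 0 0
HOM-trans = ∀S (∀S (∀S (∀S (∀S (∀S (
  GRAPH (# 0) (# 1) ⇒ GRAPH (# 2) (# 3) ⇒ GRAPH (# 4) (# 5) ⇒
  ((HOM (# 0) (# 1) (# 2) (# 3) ∧' HOM (# 2) (# 3) (# 4) (# 5))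
    ⇒ HOM (# 0) (# 1) (# 4) (# 5))))))))

-- Given homomorphisms Z₁ : G → H and Z₂ : H → S, Σ^B_0-comprehension yields the set
-- Z = {⟨i,k⟩ < ⟨|V_G|,|V_S|⟩ : ∃ j < |V_H| (Z₁(i,j) ∧ Z₂(j,k))}, the graph of Z₂ ∘ Z₁.
-- Totality, functionality and edge preservation of Z follow from those of Z₁ and Z₂
-- once membership ⟨i,k⟩ ∈ Z can be decoded, which needs ⟨a,b⟩ < ⟨c,d⟩ for a < c,
-- b < d and injectivity of pairing. These facts of arithmetic are derived in V⁰ by
-- Σ^B_0 induction, which V⁰ proves from comprehension through the maximal element of a set.

module Submission where

open import Defs
open import Data.Nat using (ℕ; zero; suc)
open import Data.Fin using (Fin; zero; suc; #_)
open import Data.List using (List; []; _∷_; map; length; lookup)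
open import Data.List.Relation.Unary.Any using (here; there)
open import Data.List.Membership.Propositional using (_∈_)
open import Data.List.Membership.Propositional.Properties using (∈-map⁺)
open import Function using (id; _∘_)
open import Relation.Binary.PropositionalEquality using (_≡_; refl; sym; trans; cong; cong₂; subst)

private variable
  n s : ℕ
  Γ : List (Fm n s)

v0 : ∀ {n s} → Tm (suc n) s
v0 = var zero
v1 : ∀ {n s} → Tm (suc (suc n)) s
v1 = var (# 1)
v2 : ∀ {n s} → Tm (suc (suc (suc n))) s
v2 = var (# 2)
v3 : ∀ {n s} → Tm (suc (suc (suc (suc n)))) s
v3 = var (# 3)
v4 : ∀ {n s} → Tm (suc (suc (suc (suc (suc n))))) s
v4 = var (# 4)

var₊₁ : ∀ {n s} → Fin n → Tm (suc n) s
var₊₁ i = var (suc i)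
var₊₂ : ∀ {n s} → Fin n → Tm (suc (suc n)) s
var₊₂ i = var (suc (suc i))
var₊₃ : ∀ {n s} → Fin n → Tm (suc (suc (suc n))) s
var₊₃ i = var (suc (suc (suc i)))

renTm-as-substTm : ∀ {n n' s s'} (t : Tm n s) {ρ : Fin n → Fin n'} {σ : Fin s → Fin s'} →
  renTm ρ σ t ≡ substTm (var ∘ ρ) σ t
renTm-as-substTm (var i)  = refl
renTm-as-substTm `0       = refl
renTm-as-substTm `1       = refl
renTm-as-substTm (t `+ u) = cong₂ _`+_ (renTm-as-substTm t) (renTm-as-substTm u)
renTm-as-substTm (t `· u) = cong₂ _`·_ (renTm-as-substTm t) (renTm-as-substTm u)
renTm-as-substTm ∣ X ∣    = refl

substTm-id : ∀ {n s} (t : Tm n s) {f : Fin n → Tm n s} {g : Fin s → Fin s} →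
  (∀ i → f i ≡ var i) → (∀ i → g i ≡ i) → substTm f g t ≡ t
substTm-id (var i)  p q = p i
substTm-id `0       p q = refl
substTm-id `1       p q = refl
substTm-id (t `+ u) p q = cong₂ _`+_ (substTm-id t p q) (substTm-id u p q)
substTm-id (t `· u) p q = cong₂ _`·_ (substTm-id t p q) (substTm-id u p q)
substTm-id ∣ X ∣    p q = cong ∣_∣ (q X)

substTm-fusion : ∀ {n n' n'' s s' s''} (t : Tm n s)
  {f : Fin n' → Tm n'' s''} {g : Fin s' → Fin s''} {f' : Fin n → Tm n' s'} {g' : Fin s → Fin s'}
  {F : Fin n → Tm n'' s''} {G : Fin s → Fin s''} →
  (∀ i → substTm f g (f' i) ≡ F i) → (∀ i → g (g' i) ≡ G i) →
  substTm f g (substTm f' g' t) ≡ substTm F G t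
substTm-fusion (var i)  p q = p i
substTm-fusion `0       p q = refl
substTm-fusion `1       p q = refl
substTm-fusion (t `+ u) p q = cong₂ _`+_ (substTm-fusion t p q) (substTm-fusion u p q)
substTm-fusion (t `· u) p q = cong₂ _`·_ (substTm-fusion t p q) (substTm-fusion u p q)
substTm-fusion ∣ X ∣    p q = cong ∣_∣ (q X)

substTm-renTm-fusion : ∀ {n n' n'' s s' s''} (t : Tm n s)
  {f : Fin n' → Tm n'' s''} {g : Fin s' → Fin s''} {ρ : Fin n → Fin n'} {σ : Fin s → Fin s'}
  {F : Fin n → Tm n'' s''} {G : Fin s → Fin s''} →
  (∀ i → f (ρ i) ≡ F i) → (∀ i → g (σ i) ≡ G i) → substTm f g (renTm ρ σ t) ≡ substTm F G t
substTm-renTm-fusion t p q = trans (cong (substTm _ _) (renTm-as-substTm t)) (substTm-fusion t p q)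

renTm-substTm-fusion : ∀ {n n' n'' s s' s''} (t : Tm n s)
  {ρ : Fin n' → Fin n''} {σ : Fin s' → Fin s''} {f : Fin n → Tm n' s'} {g : Fin s → Fin s'}
  {F : Fin n → Tm n'' s''} {G : Fin s → Fin s''} →
  (∀ i → renTm ρ σ (f i) ≡ F i) → (∀ i → σ (g i) ≡ G i) → renTm ρ σ (substTm f g t) ≡ substTm F G t
renTm-substTm-fusion t {f = f} p q =
  trans (renTm-as-substTm (substTm _ _ t))
        (substTm-fusion t (λ i → trans (sym (renTm-as-substTm (f i))) (p i)) q)

substTm-wkTmN : ∀ {n s} (t : Tm n s) {f : Fin (suc n) → Tm n s} →
  (∀ i → f (suc i) ≡ var i) → substTm f id (wkTmN t) ≡ t
substTm-wkTmN t p =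
  trans (substTm-renTm-fusion t {F = var} {G = id} p (λ _ → refl)) (substTm-id t (λ _ → refl) (λ _ → refl))

wkTmN-substTm : ∀ {n n' s s'} (t : Tm n s) (f : Fin n → Tm n' s') (g : Fin s → Fin s') →
  wkTmN (substTm f g t) ≡ substTm (liftN f) g (wkTmN t)
wkTmN-substTm t f g =
  trans (renTm-substTm-fusion t {F = wkTmN ∘ f} {G = g} (λ _ → refl) (λ _ → refl))
        (sym (substTm-renTm-fusion t {F = wkTmN ∘ f} {G = g} (λ _ → refl) (λ _ → refl)))

liftN-id : ∀ {n s} {f : Fin n → Tm n s} → (∀ i → f i ≡ var i) → ∀ i → liftN f i ≡ var i
liftN-id p zero    = refl
liftN-id p (suc i) = cong wkTmN (p i)

liftS-id : ∀ {s} {g : Fin s → Fin s} → (∀ i → g i ≡ i) → ∀ i → liftS g i ≡ i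
liftS-id q zero    = refl
liftS-id q (suc i) = cong suc (q i)

sub-id : ∀ {n s} (φ : Fm n s) {f : Fin n → Tm n s} {g : Fin s → Fin s} →
  (∀ i → f i ≡ var i) → (∀ i → g i ≡ i) → sub f g φ ≡ φ
sub-id (t ≐ u)  p q = cong₂ _≐_ (substTm-id t p q) (substTm-id u p q)
sub-id (X ≐ₛ Y) p q = cong₂ _≐ₛ_ (q X) (q Y)
sub-id (t ≤' u) p q = cong₂ _≤'_ (substTm-id t p q) (substTm-id u p q)
sub-id (t ∈' X) p q = cong₂ _∈'_ (substTm-id t p q) (q X)
sub-id ⊥'       p q = refl
sub-id (φ ⇒ ψ)  p q = cong₂ _⇒_ (sub-id φ p q) (sub-id ψ p q)
sub-id (φ ∧' ψ) p q = cong₂ _∧'_ (sub-id φ p q) (sub-id ψ p q)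
sub-id (φ ∨' ψ) p q = cong₂ _∨'_ (sub-id φ p q) (sub-id ψ p q)
sub-id (∀N φ)   p q = cong ∀N (sub-id φ (liftN-id p) q)
sub-id (∃N φ)   p q = cong ∃N (sub-id φ (liftN-id p) q)
sub-id (∀S φ)   p q = cong ∀S (sub-id φ (λ i → cong (renTm id suc) (p i)) (liftS-id q))
sub-id (∃S φ)   p q = cong ∃S (sub-id φ (λ i → cong (renTm id suc) (p i)) (liftS-id q))

module _ {n n' n'' s' s''} {f : Fin n' → Tm n'' s''} {g : Fin s' → Fin s''}
         {f' : Fin n → Tm n' s'} {F : Fin n → Tm n'' s''} where

  liftN-fusion : (∀ i → substTm f g (f' i) ≡ F i) → ∀ i → substTm (liftN f) g (liftN f' i) ≡ liftN F i
  liftN-fusion p zero    = refl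
  liftN-fusion p (suc i) =
    trans (substTm-renTm-fusion (f' i) {F = wkTmN ∘ f} {G = g} (λ _ → refl) (λ _ → refl))
          (trans (sym (renTm-substTm-fusion (f' i) (λ _ → refl) (λ _ → refl))) (cong wkTmN (p i)))

  liftNS-fusion : (∀ i → substTm f g (f' i) ≡ F i) →
    ∀ i → substTm (liftNS f) (liftS g) (liftNS f' i) ≡ liftNS F i
  liftNS-fusion p i =
    trans (substTm-renTm-fusion (f' i) {F = renTm id suc ∘ f} {G = suc ∘ g} (λ _ → refl) (λ _ → refl))
          (trans (sym (renTm-substTm-fusion (f' i) (λ _ → refl) (λ _ → refl))) (cong (renTm id suc) (p i)))

liftS-fusion : ∀ {s s' s''} {g : Fin s' → Fin s''} {g' : Fin s → Fin s'} {G : Fin s → Fin s''} →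
  (∀ i → g (g' i) ≡ G i) → ∀ i → liftS g (liftS g' i) ≡ liftS G i
liftS-fusion q zero    = refl
liftS-fusion q (suc i) = cong suc (q i)

sub-fusion : ∀ {n n' n'' s s' s''} (φ : Fm n s)
  {f : Fin n' → Tm n'' s''} {g : Fin s' → Fin s''} {f' : Fin n → Tm n' s'} {g' : Fin s → Fin s'}
  {F : Fin n → Tm n'' s''} {G : Fin s → Fin s''} →
  (∀ i → substTm f g (f' i) ≡ F i) → (∀ i → g (g' i) ≡ G i) → sub f g (sub f' g' φ) ≡ sub F G φ
sub-fusion (t ≐ u)  p q = cong₂ _≐_ (substTm-fusion t p q) (substTm-fusion u p q)
sub-fusion (X ≐ₛ Y) p q = cong₂ _≐ₛ_ (q X) (q Y)
sub-fusion (t ≤' u) p q = cong₂ _≤'_ (substTm-fusion t p q) (substTm-fusion u p q)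
sub-fusion (t ∈' X) p q = cong₂ _∈'_ (substTm-fusion t p q) (q X)
sub-fusion ⊥'       p q = refl
sub-fusion (φ ⇒ ψ)  p q = cong₂ _⇒_ (sub-fusion φ p q) (sub-fusion ψ p q)
sub-fusion (φ ∧' ψ) p q = cong₂ _∧'_ (sub-fusion φ p q) (sub-fusion ψ p q)
sub-fusion (φ ∨' ψ) p q = cong₂ _∨'_ (sub-fusion φ p q) (sub-fusion ψ p q)
sub-fusion (∀N φ) {f} {g} {f'} {F = F} p q = cong ∀N (sub-fusion φ (liftN-fusion {f = f} {g} {f'} {F} p) q)
sub-fusion (∃N φ) {f} {g} {f'} {F = F} p q = cong ∃N (sub-fusion φ (liftN-fusion {f = f} {g} {f'} {F} p) q)
sub-fusion (∀S φ) {f} {g} {f'} {F = F} p q =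
  cong ∀S (sub-fusion φ (liftNS-fusion {f = f} {g} {f'} {F} p) (liftS-fusion q))
sub-fusion (∃S φ) {f} {g} {f'} {F = F} p q =
  cong ∃S (sub-fusion φ (liftNS-fusion {f = f} {g} {f'} {F} p) (liftS-fusion q))

sub-cong : ∀ {n n' s s'} (φ : Fm n s) {f f' : Fin n → Tm n' s'} {g g' : Fin s → Fin s'} →
  (∀ i → f i ≡ f' i) → (∀ i → g i ≡ g' i) → sub f g φ ≡ sub f' g' φ
sub-cong φ p q = trans (cong (sub _ _) (sym (sub-id φ (λ _ → refl) (λ _ → refl)))) (sub-fusion φ p q)

IsΣB0-sub : ∀ {n n' s s'} {φ : Fm n s} (f : Fin n → Tm n' s') (g : Fin s → Fin s') →
  IsΣB0 φ → IsΣB0 (sub f g φ)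
IsΣB0-sub f g (eq t u)    = eq _ _
IsΣB0-sub f g (eqS X Y)   = eqS _ _
IsΣB0-sub f g (le t u)    = le _ _
IsΣB0-sub f g (mem t X)   = mem _ _
IsΣB0-sub f g bot         = bot
IsΣB0-sub f g (imp a b)   = imp (IsΣB0-sub f g a) (IsΣB0-sub f g b)
IsΣB0-sub f g (and a b)   = and (IsΣB0-sub f g a) (IsΣB0-sub f g b)
IsΣB0-sub f g (or a b)    = or (IsΣB0-sub f g a) (IsΣB0-sub f g b)
IsΣB0-sub f g (all≤ t {φ} h) =
  subst (λ w → IsΣB0 (∀N ((var zero ≤' w) ⇒ sub (liftN f) g φ))) (wkTmN-substTm t f g)
        (all≤ (substTm f g t) (IsΣB0-sub (liftN f) g h))
IsΣB0-sub f g (ex≤ t {φ} h) =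
  subst (λ w → IsΣB0 (∃N ((var zero ≤' w) ∧' sub (liftN f) g φ))) (wkTmN-substTm t f g)
        (ex≤ (substTm f g t) (IsΣB0-sub (liftN f) g h))
IsΣB0-sub f g (all< t {φ} h) =
  subst (λ w → IsΣB0 (∀N ((var zero <' w) ⇒ sub (liftN f) g φ))) (wkTmN-substTm t f g)
        (all< (substTm f g t) (IsΣB0-sub (liftN f) g h))
IsΣB0-sub f g (ex< t {φ} h) =
  subst (λ w → IsΣB0 (∃N ((var zero <' w) ∧' sub (liftN f) g φ))) (wkTmN-substTm t f g)
        (ex< (substTm f g t) (IsΣB0-sub (liftN f) g h))

sub-fusion₃ : ∀ {n₀ n₁ n₂ n₃ s₀ s₁ s₂ s₃} (φ : Fm n₀ s₀)
  {f₁ : Fin n₂ → Tm n₃ s₃} {g₁ : Fin s₂ → Fin s₃} {f₂ : Fin n₁ → Tm n₂ s₂} {g₂ : Fin s₁ → Fin s₂}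
  {f₃ : Fin n₀ → Tm n₁ s₁} {g₃ : Fin s₀ → Fin s₁} {F : Fin n₀ → Tm n₃ s₃} {G : Fin s₀ → Fin s₃} →
  (∀ i → substTm f₁ g₁ (substTm f₂ g₂ (f₃ i)) ≡ F i) → (∀ i → g₁ (g₂ (g₃ i)) ≡ G i) →
  sub f₁ g₁ (sub f₂ g₂ (sub f₃ g₃ φ)) ≡ sub F G φ
sub-fusion₃ φ {f₁} {g₁} {f₂} {g₂} {f₃} {g₃} p q =
  trans (cong (sub f₁ g₁) (sub-fusion φ {F = λ i → substTm f₂ g₂ (f₃ i)} {G = g₂ ∘ g₃} (λ _ → refl) (λ _ → refl)))
        (sub-fusion φ p q)

⊤' : ∀ {n s} → Fm n s
⊤' = ⊥' ⇒ ⊥'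

⋀ : ∀ {n s} → List (Fm n s) → Fm n s
⋀ []      = ⊤'
⋀ (φ ∷ Γ) = ⋀ Γ ∧' φ

-- Derivability from hypotheses, reduced to the Hilbert calculus through ⋀ Γ ⇒ φ
-- (the deduction theorem is then the rule lam below).
infix 0 _⊩_
record _⊩_ {n s} (Γ : List (Fm n s)) (φ : Fm n s) : Set where
  constructor nd
  field run : V0 ⊢ ⋀ Γ ⇒ φ
open _⊩_

⇒-refl : ∀ {n s} {φ : Fm n s} → V0 ⊢ φ ⇒ φ
⇒-refl {φ = φ} = mp (mp S K) (K {ψ = φ})

⇒-trans : ∀ {n s} {φ ψ χ : Fm n s} → V0 ⊢ φ ⇒ ψ → V0 ⊢ ψ ⇒ χ → V0 ⊢ φ ⇒ χ
⇒-trans f g = mp (mp S (mp K g)) f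

module _ {n s : ℕ} {Γ : List (Fm n s)} where

  app : ∀ {φ ψ} → Γ ⊩ φ ⇒ ψ → Γ ⊩ φ → Γ ⊩ ψ
  app (nd f) (nd x) = nd (mp (mp S f) x)

  theorem : ∀ {φ} → V0 ⊢ φ → Γ ⊩ φ
  theorem d = nd (mp K d)

  lam : ∀ {φ ψ} → (φ ∷ Γ) ⊩ ψ → Γ ⊩ φ ⇒ ψ
  lam (nd d) = app (app (theorem S) (nd (mp K (mp K d)))) (nd ∧I)

weaken : ∀ {φ ψ} → Γ ⊩ φ → (ψ ∷ Γ) ⊩ φ
weaken (nd d) = nd (⇒-trans ∧E₁ d)

hyp : (i : Fin (length Γ)) → Γ ⊩ lookup Γ i
hyp {Γ = φ ∷ Γ} zero    = nd ∧E₂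
hyp {Γ = φ ∷ Γ} (suc i) = weaken (hyp i)

closed : ∀ {φ} → [] ⊩ φ → Γ ⊩ φ
closed (nd d) = theorem (mp d ⇒-refl)

⊩⇒⊢ : ∀ {n s} {φ : Fm n s} → [] ⊩ φ → V0 ⊢ φ
⊩⇒⊢ (nd d) = mp d ⇒-refl

cut : ∀ {φ ψ} → Γ ⊩ φ → (φ ∷ Γ) ⊩ ψ → Γ ⊩ ψ
cut a b = app (lam b) a

⊩-cast : ∀ {φ ψ} → φ ≡ ψ → Γ ⊩ φ → Γ ⊩ ψ
⊩-cast refl d = d

⇒-flip : ∀ {n s} {φ ψ χ : Fm n s} → V0 ⊢ φ ⇒ ψ ⇒ χ → V0 ⊢ ψ ⇒ φ ⇒ χ
⇒-flip d = ⊩⇒⊢ (lam (lam (app (app (theorem d) (hyp (# 0))) (hyp (# 1)))))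

module _ {n s : ℕ} {Γ : List (Fm n s)} where

  ∧-intro : ∀ {φ ψ} → Γ ⊩ φ → Γ ⊩ ψ → Γ ⊩ φ ∧' ψ
  ∧-intro a b = app (app (theorem ∧I) a) b

  ∧-elim₁ : ∀ {φ ψ} → Γ ⊩ φ ∧' ψ → Γ ⊩ φ
  ∧-elim₁ = app (theorem ∧E₁)

  ∧-elim₂ : ∀ {φ ψ} → Γ ⊩ φ ∧' ψ → Γ ⊩ ψ
  ∧-elim₂ = app (theorem ∧E₂)

  ∨-elim : ∀ {φ ψ χ} → Γ ⊩ φ ∨' ψ → (φ ∷ Γ) ⊩ χ → (ψ ∷ Γ) ⊩ χ → Γ ⊩ χ
  ∨-elim a b c = app (app (app (theorem ∨E) (lam b)) (lam c)) a

  ⊥-elim : ∀ {φ} → Γ ⊩ ⊥' → Γ ⊩ φ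
  ⊥-elim = app (theorem ⊥E)

  by-contradiction : ∀ {φ} → ((¬' φ) ∷ Γ) ⊩ ⊥' → Γ ⊩ φ
  by-contradiction a = app (theorem dne) (lam a)

  contradiction : ∀ {φ χ} → Γ ⊩ φ → Γ ⊩ ¬' φ → Γ ⊩ χ
  contradiction a b = ⊥-elim (app b a)

  ⇔-elim₁ : ∀ {φ ψ} → Γ ⊩ φ ⇔ ψ → Γ ⊩ φ → Γ ⊩ ψ
  ⇔-elim₁ a = app (∧-elim₁ a)

  ⇔-elim₂ : ∀ {φ ψ} → Γ ⊩ φ ⇔ ψ → Γ ⊩ ψ → Γ ⊩ φ
  ⇔-elim₂ a = app (∧-elim₂ a)

  by-cases : ∀ (φ : Fm n s) {χ} → (φ ∷ Γ) ⊩ χ → ((¬' φ) ∷ Γ) ⊩ χ → Γ ⊩ χ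
  by-cases φ a b =
    by-contradiction (app (hyp (# 0)) (app (weaken (lam b))
      (lam (app (hyp (# 1)) (app (weaken (weaken (lam a))) (hyp (# 0)))))))

⋀-wkN : ∀ {n s} (Γ : List (Fm n s)) → wkN (⋀ Γ) ≡ ⋀ (map wkN Γ)
⋀-wkN []      = refl
⋀-wkN (φ ∷ Γ) = cong (_∧' wkN φ) (⋀-wkN Γ)

⋀-wkS : ∀ {n s} (Γ : List (Fm n s)) → wkS (⋀ Γ) ≡ ⋀ (map wkS Γ)
⋀-wkS []      = refl
⋀-wkS (φ ∷ Γ) = cong (_∧' wkS φ) (⋀-wkS Γ)

module _ {n s : ℕ} {Γ : List (Fm n s)} where

  ∀-intro : ∀ {φ} → map wkN Γ ⊩ φ → Γ ⊩ ∀N φ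
  ∀-intro {φ} (nd d) = nd (∀Nr (subst (λ X → V0 ⊢ X ⇒ φ) (sym (⋀-wkN Γ)) d))

  ∀-elim : ∀ {φ} → Γ ⊩ ∀N φ → (t : Tm n s) → Γ ⊩ instN φ t
  ∀-elim (nd d) t = nd (⇒-trans d (∀Ne t))

  ∃-intro : ∀ {φ} (t : Tm n s) → Γ ⊩ instN φ t → Γ ⊩ ∃N φ
  ∃-intro t (nd d) = nd (⇒-trans d (∃Ni t))

  ∃-elim : ∀ {φ χ} → Γ ⊩ ∃N φ → (φ ∷ map wkN Γ) ⊩ wkN χ → Γ ⊩ χ
  ∃-elim {φ} {χ} d e = app (app (theorem (∃Nr (⇒-flip e'))) d) (nd ⇒-refl)
    where e' : V0 ⊢ wkN (⋀ Γ) ⇒ φ ⇒ wkN χ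
          e' = subst (λ X → V0 ⊢ X ⇒ φ ⇒ wkN χ) (sym (⋀-wkN Γ)) (run (lam e))

  ∀S-intro : ∀ {φ} → map wkS Γ ⊩ φ → Γ ⊩ ∀S φ
  ∀S-intro {φ} (nd d) = nd (∀Sr (subst (λ X → V0 ⊢ X ⇒ φ) (sym (⋀-wkS Γ)) d))

  ∀S-elim : ∀ {φ} → Γ ⊩ ∀S φ → (X : Fin s) → Γ ⊩ instS φ X
  ∀S-elim (nd d) X = nd (⇒-trans d (∀Se X))

  ∃S-intro : ∀ {φ} (X : Fin s) → Γ ⊩ instS φ X → Γ ⊩ ∃S φ
  ∃S-intro X (nd d) = nd (⇒-trans d (∃Si X))

  ∃S-elim : ∀ {φ χ} → Γ ⊩ ∃S φ → (φ ∷ map wkS Γ) ⊩ wkS χ → Γ ⊩ χ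
  ∃S-elim {φ} {χ} d e = app (app (theorem (∃Sr (⇒-flip e'))) d) (nd ⇒-refl)
    where e' : V0 ⊢ wkS (⋀ Γ) ⇒ φ ⇒ wkS χ
          e' = subst (λ X → V0 ⊢ X ⇒ φ ⇒ wkS χ) (sym (⋀-wkS Γ)) (run (lam e))

  ≐-refl : (t : Tm n s) → Γ ⊩ t ≐ t
  ≐-refl t = theorem (≐refl t)

  ≐-elim : (φ : Fm (suc n) s) {t u : Tm n s} → Γ ⊩ t ≐ u → Γ ⊩ instN φ t → Γ ⊩ instN φ u
  ≐-elim φ {t} {u} a = app (app (theorem (≐subst φ t u)) a)

  ∀<-elim : ∀ {b : Tm (suc n) s} {φ} → Γ ⊩ ∀N ((var zero <' b) ⇒ φ) → (t : Tm n s) →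
    Γ ⊩ instN (var zero <' b) t → Γ ⊩ instN φ t
  ∀<-elim d t = app (∀-elim d t)

-- Eliminating several quantifiers at once is stated with sub, which computes on concrete formulas.
_∷ₜ_ : ∀ {k n s} → Tm n s → (Fin k → Tm n s) → Fin (suc k) → Tm n s
(t ∷ₜ σ) zero    = t
(t ∷ₜ σ) (suc i) = σ i

module _ {n s : ℕ} {Γ : List (Fm n s)} where

  ∀-elim-sub : ∀ {k s'} {σ : Fin k → Tm n s} {g : Fin s' → Fin s} {φ : Fm (suc k) s'} →
    Γ ⊩ sub σ g (∀N φ) → (t : Tm n s) → Γ ⊩ sub (t ∷ₜ σ) g φ
  ∀-elim-sub {σ = σ} {φ = φ} d t = ⊩-cast (sub-fusion φ same (λ _ → refl)) (∀-elim d t)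
    where same : ∀ i → substTm _ id (liftN σ i) ≡ (t ∷ₜ σ) i
          same zero    = refl
          same (suc i) = substTm-wkTmN (σ i) (λ _ → refl)

  ∀-elim₂ : ∀ {φ : Fm (suc (suc n)) s} → Γ ⊩ ∀N (∀N φ) → (t u : Tm n s) →
    Γ ⊩ sub (u ∷ₜ (t ∷ₜ var)) id φ
  ∀-elim₂ {φ} d t u = ∀-elim-sub (∀-elim-sub (⊩-cast (sym (sub-id (∀N (∀N φ)) (λ _ → refl) (λ _ → refl))) d) t) u

  ∀-elim₃ : ∀ {φ : Fm (suc (suc (suc n))) s} → Γ ⊩ ∀N (∀N (∀N φ)) → (t u v : Tm n s) →
    Γ ⊩ sub (v ∷ₜ (u ∷ₜ (t ∷ₜ var))) id φ
  ∀-elim₃ d t u v = ∀-elim-sub (∀-elim₂ d t u) v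

  ∀-elim₄ : ∀ {φ : Fm (suc (suc (suc (suc n)))) s} → Γ ⊩ ∀N (∀N (∀N (∀N φ))) → (t u v w : Tm n s) →
    Γ ⊩ sub (w ∷ₜ (v ∷ₜ (u ∷ₜ (t ∷ₜ var)))) id φ
  ∀-elim₄ d t u v w = ∀-elim-sub (∀-elim₃ d t u v) w

  ≐-elim-sub : ∀ {k s'} (φ : Fm (suc k) s') {σ : Fin k → Tm n s} {g : Fin s' → Fin s} {t u : Tm n s} →
    Γ ⊩ t ≐ u → Γ ⊩ sub (t ∷ₜ σ) g φ → Γ ⊩ sub (u ∷ₜ σ) g φ
  ≐-elim-sub φ {σ} {g} {t} {u} p d = ⊩-cast (at u) (≐-elim ψ p (⊩-cast (sym (at t)) d))
    where ψ : Fm (suc n) s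
          ψ = sub (var zero ∷ₜ (wkTmN ∘ σ)) g φ
          at : ∀ w → instN ψ w ≡ sub (w ∷ₜ σ) g φ
          at w = sub-fusion φ (λ { zero → refl ; (suc i) → substTm-wkTmN (σ i) (λ _ → refl) }) (λ _ → refl)

-- Lemmas about arbitrary terms are proved once, as generic, for variables, where all
-- substitutions compute, and then instantiated.
module _ {n s : ℕ} {Γ : List (Fm n s)} {t u : Tm n s} where

  ≐-sym : Γ ⊩ t ≐ u → Γ ⊩ u ≐ t
  ≐-sym = app (∀-elim₂ (closed generic) t u)
    where generic : [] ⊩ ∀N (∀N ((v1 ≐ v0) ⇒ (v0 ≐ v1)))
          generic = ∀-intro (∀-intro (lam (≐-elim (v0 ≐ v2) (hyp (# 0)) (≐-refl v1))))

  ≐-trans : ∀ {v} → Γ ⊩ t ≐ u → Γ ⊩ u ≐ v → Γ ⊩ t ≐ v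
  ≐-trans {v} p q = app (app (∀-elim₃ (closed generic) t u v) p) q
    where generic : [] ⊩ ∀N (∀N (∀N ((v2 ≐ v1) ⇒ (v1 ≐ v0) ⇒ (v2 ≐ v0))))
          generic = ∀-intro (∀-intro (∀-intro (lam (lam (≐-elim (v3 ≐ v0) (hyp (# 0)) (hyp (# 1)))))))

  ≤-respˡ-≐ : ∀ {v} → Γ ⊩ t ≐ u → Γ ⊩ t ≤' v → Γ ⊩ u ≤' v
  ≤-respˡ-≐ {v} p q = app (app (∀-elim₃ (closed generic) t u v) p) q
    where generic : [] ⊩ ∀N (∀N (∀N ((v2 ≐ v1) ⇒ (v2 ≤' v0) ⇒ (v1 ≤' v0))))
          generic = ∀-intro (∀-intro (∀-intro (lam (lam (≐-elim (v0 ≤' v1) (hyp (# 1)) (hyp (# 0)))))))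

  ≤-respʳ-≐ : ∀ {v} → Γ ⊩ t ≐ u → Γ ⊩ v ≤' t → Γ ⊩ v ≤' u
  ≤-respʳ-≐ {v} p q = app (app (∀-elim₃ (closed generic) t u v) p) q
    where generic : [] ⊩ ∀N (∀N (∀N ((v2 ≐ v1) ⇒ (v0 ≤' v2) ⇒ (v0 ≤' v1))))
          generic = ∀-intro (∀-intro (∀-intro (lam (lam (≐-elim (v1 ≤' v0) (hyp (# 1)) (hyp (# 0)))))))

  ∈-resp-≐ : ∀ {X} → Γ ⊩ t ≐ u → Γ ⊩ t ∈' X → Γ ⊩ u ∈' X
  ∈-resp-≐ {X} = ≐-elim (v0 ∈' X)

≢-sym : ∀ {t u : Tm n s} → Γ ⊩ ¬' (t ≐ u) → Γ ⊩ ¬' (u ≐ t)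
≢-sym p = lam (app (weaken p) (≐-sym (hyp (# 0))))

infixr 5 _∙_
_∙_ : ∀ {t u v : Tm n s} → Γ ⊩ t ≐ u → Γ ⊩ u ≐ v → Γ ⊩ t ≐ v
_∙_ = ≐-trans

module _ {n s : ℕ} {Γ : List (Fm n s)} {t t' u u' : Tm n s} where

  +-cong : Γ ⊩ t ≐ t' → Γ ⊩ u ≐ u' → Γ ⊩ t `+ u ≐ t' `+ u'
  +-cong p q = app (app (∀-elim₄ (closed generic) t t' u u') p) q
    where generic : [] ⊩ ∀N (∀N (∀N (∀N ((v3 ≐ v2) ⇒ (v1 ≐ v0) ⇒ (v3 `+ v1 ≐ v2 `+ v0)))))
          generic = ∀-intro (∀-intro (∀-intro (∀-intro (lam (lam
            (≐-elim (v4 `+ v2 ≐ v3 `+ v0) (hyp (# 0))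
              (≐-elim (v4 `+ v2 ≐ v0 `+ v2) (hyp (# 1)) (≐-refl (v3 `+ v1)))))))))

  ·-cong : Γ ⊩ t ≐ t' → Γ ⊩ u ≐ u' → Γ ⊩ t `· u ≐ t' `· u'
  ·-cong p q = app (app (∀-elim₄ (closed generic) t t' u u') p) q
    where generic : [] ⊩ ∀N (∀N (∀N (∀N ((v3 ≐ v2) ⇒ (v1 ≐ v0) ⇒ (v3 `· v1 ≐ v2 `· v0)))))
          generic = ∀-intro (∀-intro (∀-intro (∀-intro (lam (lam
            (≐-elim (v4 `· v2 ≐ v3 `· v0) (hyp (# 0))
              (≐-elim (v4 `· v2 ≐ v0 `· v2) (hyp (# 1)) (≐-refl (v3 `· v1)))))))))

module _ {n s : ℕ} {Γ : List (Fm n s)} where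

  ⟨⟩-cong : ∀ {t t' u u' : Tm n s} → Γ ⊩ t ≐ t' → Γ ⊩ u ≐ u' → Γ ⊩ ⟨ t , u ⟩ ≐ ⟨ t' , u' ⟩
  ⟨⟩-cong p q = +-cong (·-cong (+-cong p q) (+-cong (+-cong p q) (≐-refl `1))) (·-cong (≐-refl (`1 `+ `1)) q)

  +-congʳ : ∀ {t t'} (u : Tm n s) → Γ ⊩ t ≐ t' → Γ ⊩ t `+ u ≐ t' `+ u
  +-congʳ u p = +-cong p (≐-refl u)

  +-congˡ : ∀ (t : Tm n s) {u u'} → Γ ⊩ u ≐ u' → Γ ⊩ t `+ u ≐ t `+ u'
  +-congˡ t = +-cong (≐-refl t)

  ·-congˡ : ∀ (t : Tm n s) {u u'} → Γ ⊩ u ≐ u' → Γ ⊩ t `· u ≐ t `· u'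
  ·-congˡ t = ·-cong (≐-refl t)

  +-identityʳ : (x : Tm n s) → Γ ⊩ x `+ `0 ≐ x
  +-identityʳ x = ∀-elim₂ (theorem (ax b3)) x x

  +-suc : (x y : Tm n s) → Γ ⊩ x `+ (y `+ `1) ≐ (x `+ y) `+ `1
  +-suc x y = ∀-elim₂ (theorem (ax b4)) y x

  +1-injective : ∀ {x y : Tm n s} → Γ ⊩ x `+ `1 ≐ y `+ `1 → Γ ⊩ x ≐ y
  +1-injective {x} {y} = app (∀-elim₂ (theorem (ax b2)) y x)

  ·-zeroʳ : (x : Tm n s) → Γ ⊩ x `· `0 ≐ `0
  ·-zeroʳ x = ∀-elim₂ (theorem (ax b5)) x x

  ·-suc : (x y : Tm n s) → Γ ⊩ x `· (y `+ `1) ≐ (x `· y) `+ x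
  ·-suc x y = ∀-elim₂ (theorem (ax b6)) y x

  ≤-antisym : ∀ {x y : Tm n s} → Γ ⊩ x ≤' y → Γ ⊩ y ≤' x → Γ ⊩ x ≐ y
  ≤-antisym {x} {y} p q = app (∀-elim₂ (theorem (ax b7)) y x) (∧-intro p q)

  m≤m+n : (x y : Tm n s) → Γ ⊩ x ≤' x `+ y
  m≤m+n x y = ∀-elim₂ (theorem (ax b8)) y x

  0≤ : (x : Tm n s) → Γ ⊩ `0 ≤' x
  0≤ x = ∀-elim₂ (theorem (ax b9)) x x

  ≤-total : (x y : Tm n s) → Γ ⊩ (x ≤' y) ∨' (y ≤' x)
  ≤-total x y = ∀-elim₂ (theorem (ax b10)) y x

  ≤⇔<+1 : (x y : Tm n s) → Γ ⊩ (x ≤' y) ⇔ (x <' y `+ `1)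
  ≤⇔<+1 x y = ∀-elim₂ (theorem (ax b11)) y x

  ≢0⇒∃pred : ∀ {x : Tm n s} → Γ ⊩ ¬' (x ≐ `0) → Γ ⊩ ∃N ((v0 ≤' wkTmN x) ∧' (v0 `+ `1 ≐ wkTmN x))
  ≢0⇒∃pred {x} = app (∀-elim₂ (theorem (ax b12)) x x)

  ∈⇒<∣∣ : ∀ {X} {x : Tm n s} → Γ ⊩ x ∈' X → Γ ⊩ x <' ∣ X ∣
  ∈⇒<∣∣ {X} {x} = app (∀-elim (∀S-elim (theorem (ax l1)) X) x)

  +1≐∣∣⇒∈ : ∀ {X} {x : Tm n s} → Γ ⊩ x `+ `1 ≐ ∣ X ∣ → Γ ⊩ x ∈' X
  +1≐∣∣⇒∈ {X} {x} = app (∀-elim (∀S-elim (theorem (ax l2)) X) x)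

module _ {n s : ℕ} where

  +1≰ : ∀ {Γ : List (Fm n s)} (x : Tm n s) → Γ ⊩ ¬' (x `+ `1 ≤' x)
  +1≰ x = lam (contradiction (≐-refl (x `+ `1)) (∧-elim₂ (⇔-elim₁ (≤⇔<+1 (x `+ `1) x) (hyp (# 0)))))

  +1≤⇒≤ : ∀ {Γ : List (Fm n s)} {x y : Tm n s} → Γ ⊩ x `+ `1 ≤' y → Γ ⊩ x ≤' y
  +1≤⇒≤ {x = x} {y} p = ∨-elim (≤-total x y) (hyp (# 0))
    (cut (⇔-elim₁ (≤⇔<+1 y x) (hyp (# 0)))
      (contradiction (≐-sym (≤-antisym (weaken (weaken p)) (∧-elim₁ (hyp (# 0))))) (∧-elim₂ (hyp (# 0)))))

  +1≤⇒< : ∀ {Γ : List (Fm n s)} {x y : Tm n s} → Γ ⊩ x `+ `1 ≤' y → Γ ⊩ x <' y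
  +1≤⇒< {x = x} p = ∧-intro (+1≤⇒≤ p) (lam (app (+1≰ x) (≤-respʳ-≐ (≐-sym (hyp (# 0))) (weaken p))))

close-elimN : ∀ {s} (n : ℕ) (χ : Fm n s) {n' s'} (f : Fin n → Tm n' s') (g : Fin s → Fin s') →
  V0 ⊢ sub {n' = n'} (λ ()) g (closeN χ) → V0 ⊢ sub f g χ
close-elimN zero    χ f g d = subst (V0 ⊢_) (sub-cong χ (λ ()) (λ _ → refl)) d
close-elimN (suc n) χ f g d =
  subst (V0 ⊢_) (sub-fusion χ same (λ _ → refl)) (mp (∀Ne (f zero)) (close-elimN n (∀N χ) (f ∘ suc) g d))
  where same : ∀ i → _ ≡ f i
        same zero    = refl
        same (suc i) = substTm-wkTmN (f (suc i)) (λ _ → refl)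

close-elimS : ∀ (s : ℕ) (χ : Fm 0 s) {n' s'} (g : Fin s → Fin s') →
  V0 ⊢ sub {n' = n'} {s' = s'} (λ ()) (λ ()) (closeS χ) → V0 ⊢ sub {n' = n'} (λ ()) g χ
close-elimS zero    χ g d = subst (V0 ⊢_) (sub-cong χ (λ ()) (λ ())) d
close-elimS (suc s) χ g d =
  subst (V0 ⊢_) (sub-fusion χ (λ ()) same) (mp (∀Se (g zero)) (close-elimS s (∀S χ) (g ∘ suc) d))
  where same : ∀ i → _ ≡ g i
        same zero    = refl
        same (suc i) = refl

close-elim : ∀ {n s} (ψ : Fm n s) → V0 ⊢ embed {n} {s} (close ψ) → V0 ⊢ ψ
close-elim {n} {s} ψ d = subst (V0 ⊢_) (sub-id ψ (λ _ → refl) (λ _ → refl))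
  (close-elimN n ψ var id (close-elimS s (closeN ψ) {n' = n} id d))

-- Σ^B_0 induction

_[x+1] : ∀ {n s} → Fm (suc n) s → Fm (suc n) s
φ [x+1] = sub ((v0 `+ `1) ∷ₜ var₊₁) id φ

-- V⁰ has no induction axiom. For x ≠ 0 comprehension gives X = {z < x : φ z}, and
-- 0 ∈ X, so |X| = M + 1 with M ∈ X (L2); then φ M and φ (M + 1). If M + 1 < x then
-- M + 1 ∈ X, contradicting M + 1 = |X| (L1); hence M + 1 = x.
module Induction {n s : ℕ} (φ : Fm (suc n) s) (Σ₀φ : IsΣB0 φ) where

  Base Step : Fm n s
  Base = instN φ `0
  Step = ∀N (φ ⇒ φ [x+1])

  φ↑ : Fm (suc (suc n)) s
  φ↑ = sub (v0 ∷ₜ var₊₂) id φ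

  comprehension : V0 ⊢ COMP φ↑ zero
  comprehension = close-elim (COMP φ↑ zero) (ax (comp φ↑ (IsΣB0-sub _ id Σ₀φ) zero))

  IsX : Fm (suc n) (suc s)
  IsX = (∣ zero ∣ ≤' v0) ∧' ∀N ((v0 <' v1) ⇒ ((v0 ∈' zero) ⇔ wkS φ↑))

  -- φ at t in the contexts (x; X) and (x, M; X) of the proof
  φ₁ : Tm (suc n) (suc s) → Fm (suc n) (suc s)
  φ₁ t = sub (t ∷ₜ var₊₁) suc φ

  φ₂ : Tm (suc (suc n)) (suc s) → Fm (suc (suc n)) (suc s)
  φ₂ t = sub (t ∷ₜ var₊₂) suc φ

  X-iff₁ : ∀ {Γ} {t} → Γ ⊩ IsX → Γ ⊩ t <' v0 → Γ ⊩ (t ∈' zero) ⇔ φ₁ t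
  X-iff₁ {t = t} isX lt = ⊩-cast (cong ((t ∈' zero) ⇔_) same) (∀<-elim (∧-elim₂ isX) t lt)
    where same : instN (wkS φ↑) t ≡ φ₁ t
          same = sub-fusion₃ φ (λ { zero → refl ; (suc i) → refl }) (λ _ → refl)

  X-iff₂ : ∀ {Γ} {t} → Γ ⊩ wkN IsX → Γ ⊩ t <' v1 → Γ ⊩ (t ∈' zero) ⇔ φ₂ t
  X-iff₂ {t = t} isX lt = ⊩-cast (cong ((t ∈' zero) ⇔_) same) (∀<-elim (∧-elim₂ isX) t lt)
    where same : instN (sub (liftN (var ∘ suc)) id (wkS φ↑)) t ≡ φ₂ t
          same = trans (cong (λ ψ → instN ψ t)
                        (sub-fusion₃ φ {F = v0 ∷ₜ var₊₃} (λ { zero → refl ; (suc i) → refl }) (λ _ → refl)))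
                     (sub-fusion φ (λ { zero → refl ; (suc i) → refl }) (λ _ → refl))

  step₂ : ∀ {Γ} → Γ ⊩ wkN (wkS (wkN Step)) → (t : Tm (suc (suc n)) (suc s)) → Γ ⊩ φ₂ t ⇒ φ₂ (t `+ `1)
  step₂ st t = ⊩-cast (cong₂ _⇒_ (at φ) (trans (at (φ [x+1])) (sub-fusion φ (λ { zero → refl ; (suc i) → refl }) (λ _ → refl))))
                      (∀-elim st t)
    where at : ∀ ψ → instN (sub (liftN (var ∘ suc)) id (sub (liftN var) suc (sub (liftN (var ∘ suc)) id ψ))) t
                     ≡ sub (t ∷ₜ var₊₂) suc ψ
          at ψ = trans (cong (λ χ → instN χ t)
                          (sub-fusion₃ ψ {F = v0 ∷ₜ var₊₃} (λ { zero → refl ; (suc i) → refl }) (λ _ → refl)))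
                       (sub-fusion ψ (λ { zero → refl ; (suc i) → refl }) (λ _ → refl))

  x≐0-case : (v0 ≐ `0) ∷ wkN Step ∷ wkN Base ∷ [] ⊩ φ
  x≐0-case = ⊩-cast (sub-id φ (λ { zero → refl ; (suc i) → refl }) (λ _ → refl))
                    (≐-elim-sub φ (≐-sym (hyp (# 0))) (⊩-cast base-at-0 (hyp (# 2))))
    where base-at-0 : wkN Base ≡ sub (`0 ∷ₜ var₊₁) id φ
          base-at-0 = sub-fusion φ (λ { zero → refl ; (suc i) → refl }) (λ _ → refl)

  X-empty-case : (∣ zero ∣ ≐ `0) ∷ IsX ∷ map wkS (¬' (v0 ≐ `0) ∷ wkN Step ∷ wkN Base ∷ []) ⊩ wkS φ
  X-empty-case = contradiction (≐-sym (hyp (# 0))) (∧-elim₂ (∈⇒<∣∣ 0∈X))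
    where base₁ : wkS (wkN Base) ≡ φ₁ `0
          base₁ = sub-fusion₃ φ (λ { zero → refl ; (suc i) → refl }) (λ _ → refl)
          0∈X = ⇔-elim₂ (X-iff₁ (hyp (# 1)) (∧-intro (0≤ v0) (≢-sym (hyp (# 2))))) (⊩-cast base₁ (hyp (# 4)))

  X-last-case : ((v0 ≤' ∣ zero ∣) ∧' (v0 `+ `1 ≐ ∣ zero ∣)) ∷
                map wkN (¬' (∣ zero ∣ ≐ `0) ∷ IsX ∷ map wkS (¬' (v0 ≐ `0) ∷ wkN Step ∷ wkN Base ∷ []))
                ⊩ wkN (wkS φ)
  X-last-case =
    cut (≤-respˡ-≐ (≐-sym (∧-elim₂ (hyp (# 0)))) (∧-elim₁ (hyp (# 2))))
    (cut (app (step₂ (hyp (# 5)) v0)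
           (⇔-elim₁ (X-iff₂ (hyp (# 3)) (+1≤⇒< (hyp (# 0)))) (+1≐∣∣⇒∈ (∧-elim₂ (hyp (# 1))))))
    (by-cases (v0 `+ `1 ≐ v1)
      (⊩-cast (sym (sub-fusion φ (λ { zero → refl ; (suc i) → refl }) (λ _ → refl)))
              (≐-elim-sub φ (hyp (# 0)) (hyp (# 1))))
      (contradiction (∧-elim₂ (hyp (# 3)))
        (∧-elim₂ (∈⇒<∣∣ (⇔-elim₂ (X-iff₂ (hyp (# 5)) (∧-intro (hyp (# 2)) (hyp (# 0)))) (hyp (# 1))))))))

  induction : [] ⊩ Base ⇒ Step ⇒ ∀N φ
  induction = lam (lam (∀-intro
    (by-cases (v0 ≐ `0) x≐0-case
      (∃S-elim (theorem comprehension)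
        (by-cases (∣ zero ∣ ≐ `0) X-empty-case (∃-elim (≢0⇒∃pred (hyp (# 0))) X-last-case))))))

Σ₀-induction : (φ : Fm (suc n) s) → IsΣB0 φ →
  Γ ⊩ instN φ `0 → Γ ⊩ ∀N (φ ⇒ φ [x+1]) → Γ ⊩ ∀N φ
Σ₀-induction φ Σ₀φ base step = app (app (closed (Induction.induction φ Σ₀φ)) base) step

-- Arithmetic

+-identityˡ : (x : Tm n s) → Γ ⊩ `0 `+ x ≐ x
+-identityˡ x = ∀-elim (closed generic) x
  where generic : [] ⊩ ∀N (`0 `+ v0 ≐ v0)
        generic = Σ₀-induction _ (eq _ _) (+-identityʳ `0)
          (∀-intro (lam (+-suc `0 v0 ∙ +-congʳ `1 (hyp (# 0)))))

suc-+ : (x y : Tm n s) → Γ ⊩ (x `+ `1) `+ y ≐ (x `+ y) `+ `1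
suc-+ x y = ∀-elim₂ (closed generic) x y
  where generic : [] ⊩ ∀N (∀N ((v1 `+ `1) `+ v0 ≐ (v1 `+ v0) `+ `1))
        generic = ∀-intro (Σ₀-induction _ (eq _ _)
          (+-identityʳ (v0 `+ `1) ∙ +-congʳ `1 (≐-sym (+-identityʳ v0)))
          (∀-intro (lam (+-suc (v1 `+ `1) v0 ∙ +-congʳ `1 (hyp (# 0)) ∙ +-congʳ `1 (≐-sym (+-suc v1 v0))))))

+-comm : (x y : Tm n s) → Γ ⊩ x `+ y ≐ y `+ x
+-comm x y = ∀-elim₂ (closed generic) x y
  where generic : [] ⊩ ∀N (∀N (v1 `+ v0 ≐ v0 `+ v1))
        generic = ∀-intro (Σ₀-induction _ (eq _ _)
          (+-identityʳ v0 ∙ ≐-sym (+-identityˡ v0))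
          (∀-intro (lam (+-suc v1 v0 ∙ +-congʳ `1 (hyp (# 0)) ∙ ≐-sym (suc-+ v0 v1)))))

+-assoc : (x y z : Tm n s) → Γ ⊩ (x `+ y) `+ z ≐ x `+ (y `+ z)
+-assoc x y z = ∀-elim₃ (closed generic) x y z
  where generic : [] ⊩ ∀N (∀N (∀N ((v2 `+ v1) `+ v0 ≐ v2 `+ (v1 `+ v0))))
        generic = ∀-intro (∀-intro (Σ₀-induction _ (eq _ _)
          (+-identityʳ (v1 `+ v0) ∙ +-congˡ v1 (≐-sym (+-identityʳ v0)))
          (∀-intro (lam (+-suc (v2 `+ v1) v0 ∙ +-congʳ `1 (hyp (# 0))
                         ∙ ≐-sym (+-suc v2 (v1 `+ v0)) ∙ +-congˡ v2 (≐-sym (+-suc v1 v0)))))))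

+-cancelʳ : ∀ {x y : Tm n s} (z : Tm n s) → Γ ⊩ x `+ z ≐ y `+ z → Γ ⊩ x ≐ y
+-cancelʳ {x = x} {y} z = app (∀-elim₃ (closed generic) x y z)
  where generic : [] ⊩ ∀N (∀N (∀N ((v2 `+ v0 ≐ v1 `+ v0) ⇒ (v2 ≐ v1))))
        generic = ∀-intro (∀-intro (Σ₀-induction _ (imp (eq _ _) (eq _ _))
          (lam (≐-sym (+-identityʳ v1) ∙ hyp (# 0) ∙ +-identityʳ v0))
          (∀-intro (lam (lam (app (hyp (# 1))
            (+1-injective (≐-sym (+-suc v2 v0) ∙ hyp (# 0) ∙ +-suc v1 v0))))))))

·-zeroˡ : (x : Tm n s) → Γ ⊩ `0 `· x ≐ `0
·-zeroˡ x = ∀-elim (closed generic) x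
  where generic : [] ⊩ ∀N (`0 `· v0 ≐ `0)
        generic = Σ₀-induction _ (eq _ _) (·-zeroʳ `0)
          (∀-intro (lam (·-suc `0 v0 ∙ +-identityʳ (`0 `· v0) ∙ hyp (# 0))))

suc-· : (x y : Tm n s) → Γ ⊩ (x `+ `1) `· y ≐ (x `· y) `+ y
suc-· x y = ∀-elim₂ (closed generic) x y
  where generic : [] ⊩ ∀N (∀N ((v1 `+ `1) `· v0 ≐ (v1 `· v0) `+ v0))
        generic = ∀-intro (Σ₀-induction _ (eq _ _)
          (·-zeroʳ (v0 `+ `1) ∙ ≐-sym (·-zeroʳ v0) ∙ ≐-sym (+-identityʳ (v0 `· `0)))
          (∀-intro (lam (·-suc (v1 `+ `1) v0 ∙ +-congʳ (v1 `+ `1) (hyp (# 0)) ∙ +-assoc (v1 `· v0) v0 (v1 `+ `1)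
            ∙ +-congˡ (v1 `· v0) (+-suc v0 v1 ∙ +-congʳ `1 (+-comm v0 v1) ∙ ≐-sym (+-suc v1 v0))
            ∙ ≐-sym (+-assoc (v1 `· v0) v1 (v0 `+ `1)) ∙ +-congʳ (v0 `+ `1) (≐-sym (·-suc v1 v0))))))

·-comm : (x y : Tm n s) → Γ ⊩ x `· y ≐ y `· x
·-comm x y = ∀-elim₂ (closed generic) x y
  where generic : [] ⊩ ∀N (∀N (v1 `· v0 ≐ v0 `· v1))
        generic = ∀-intro (Σ₀-induction _ (eq _ _)
          (·-zeroʳ v0 ∙ ≐-sym (·-zeroˡ v0))
          (∀-intro (lam (·-suc v1 v0 ∙ +-congʳ v1 (hyp (# 0)) ∙ ≐-sym (suc-· v0 v1)))))

·-distribˡ-+ : (x y z : Tm n s) → Γ ⊩ x `· (y `+ z) ≐ (x `· y) `+ (x `· z)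
·-distribˡ-+ x y z = ∀-elim₃ (closed generic) x y z
  where generic : [] ⊩ ∀N (∀N (∀N (v2 `· (v1 `+ v0) ≐ (v2 `· v1) `+ (v2 `· v0))))
        generic = ∀-intro (∀-intro (Σ₀-induction _ (eq _ _)
          (·-congˡ v1 (+-identityʳ v0) ∙ ≐-sym (+-identityʳ (v1 `· v0)) ∙ +-congˡ (v1 `· v0) (≐-sym (·-zeroʳ v1)))
          (∀-intro (lam (·-congˡ v2 (+-suc v1 v0) ∙ ·-suc v2 (v1 `+ v0) ∙ +-congʳ v2 (hyp (# 0))
            ∙ +-assoc (v2 `· v1) (v2 `· v0) v2 ∙ +-congˡ (v2 `· v1) (≐-sym (·-suc v2 v0)))))))

·-identityʳ : (x : Tm n s) → Γ ⊩ x `· `1 ≐ x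
·-identityʳ x = ·-congˡ x (≐-sym (+-identityˡ `1)) ∙ ·-suc x `0 ∙ +-congʳ x (·-zeroʳ x) ∙ +-identityˡ x

≤-refl : (x : Tm n s) → Γ ⊩ x ≤' x
≤-refl x = ≤-respʳ-≐ (+-identityʳ x) (m≤m+n x `0)

≤⇒∃+ : ∀ {x y : Tm n s} → Γ ⊩ x ≤' y → Γ ⊩ ∃N ((v0 ≤' wkTmN y) ∧' (wkTmN x `+ v0 ≐ wkTmN y))
≤⇒∃+ {x = x} {y} = app (∀-elim₂ (closed generic) y x)
  where generic : [] ⊩ ∀N (∀N ((v0 ≤' v1) ⇒ ∃N ((v0 ≤' v2) ∧' (v1 `+ v0 ≐ v2))))
        generic = Σ₀-induction _ (all≤ v0 (ex≤ v1 (eq _ _)))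
          (∀-intro (lam (∃-intro `0 (∧-intro (0≤ `0) (+-identityʳ v0 ∙ ≤-antisym (hyp (# 0)) (0≤ v0))))))
          (∀-intro (lam (∀-intro (lam (by-cases (v0 ≐ v1 `+ `1)
            (∃-intro `0 (∧-intro (0≤ (v1 `+ `1)) (+-identityʳ v0 ∙ hyp (# 0))))
            (∃-elim (app (∀-elim (hyp (# 2)) v0) (⇔-elim₂ (≤⇔<+1 v0 v1) (∧-intro (hyp (# 1)) (hyp (# 0)))))
              (∃-intro (v0 `+ `1) (∧-intro
                (≤-respʳ-≐ (+-comm (v0 `+ `1) v1 ∙ +-suc v1 v0 ∙ +-congʳ `1 (∧-elim₂ (hyp (# 0))))
                           (m≤m+n (v0 `+ `1) v1))
                (+-suc v1 v0 ∙ +-congʳ `1 (∧-elim₂ (hyp (# 0))))))))))))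

≤-trans : ∀ {x y z : Tm n s} → Γ ⊩ x ≤' y → Γ ⊩ y ≤' z → Γ ⊩ x ≤' z
≤-trans {x = x} {y} {z} p q = app (app (∀-elim₃ (closed generic) x y z) p) q
  where generic : [] ⊩ ∀N (∀N (∀N ((v2 ≤' v1) ⇒ (v1 ≤' v0) ⇒ (v2 ≤' v0))))
        generic = ∀-intro (∀-intro (∀-intro (lam (lam
          (∃-elim (≤⇒∃+ (hyp (# 1)))
            (∃-elim (≤⇒∃+ (hyp (# 1)))
              (≤-respʳ-≐ (≐-sym (+-assoc v4 v1 v0) ∙ +-congʳ v0 (∧-elim₂ (hyp (# 1))) ∙ ∧-elim₂ (hyp (# 0)))
                         (m≤m+n v4 (v1 `+ v0)))))))))

+-monoˡ-≤ : ∀ {x y : Tm n s} (z : Tm n s) → Γ ⊩ x ≤' y → Γ ⊩ x `+ z ≤' y `+ z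
+-monoˡ-≤ {x = x} {y} z = app (∀-elim₃ (closed generic) x y z)
  where generic : [] ⊩ ∀N (∀N (∀N ((v2 ≤' v1) ⇒ (v2 `+ v0 ≤' v1 `+ v0))))
        generic = ∀-intro (∀-intro (∀-intro (lam
          (∃-elim (≤⇒∃+ (hyp (# 0)))
            (≤-respʳ-≐ (+-assoc v3 v1 v0 ∙ +-congˡ v3 (+-comm v1 v0) ∙ ≐-sym (+-assoc v3 v0 v1)
                        ∙ +-congʳ v1 (∧-elim₂ (hyp (# 0))))
                       (m≤m+n (v3 `+ v1) v0))))))

·-monoʳ-≤ : ∀ {x y : Tm n s} (z : Tm n s) → Γ ⊩ x ≤' y → Γ ⊩ z `· x ≤' z `· y
·-monoʳ-≤ {x = x} {y} z = app (∀-elim₃ (closed generic) x y z)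
  where generic : [] ⊩ ∀N (∀N (∀N ((v2 ≤' v1) ⇒ (v0 `· v2 ≤' v0 `· v1))))
        generic = ∀-intro (∀-intro (∀-intro (lam
          (∃-elim (≤⇒∃+ (hyp (# 0)))
            (≤-respʳ-≐ (≐-sym (·-distribˡ-+ v1 v3 v0) ∙ ·-congˡ v1 (∧-elim₂ (hyp (# 0))))
                       (m≤m+n (v1 `· v3) (v1 `· v0)))))))

-- Order and pairing

<⇒+1≤ : ∀ {x y : Tm n s} → Γ ⊩ x <' y → Γ ⊩ x `+ `1 ≤' y
<⇒+1≤ {x = x} {y} p = cut p (∨-elim (≤-total (x `+ `1) y) (hyp (# 0))
  (by-cases (y ≐ x `+ `1) (≤-respˡ-≐ (hyp (# 0)) (≤-refl y))
    (contradiction (≤-antisym (∧-elim₁ (hyp (# 2))) (⇔-elim₂ (≤⇔<+1 y x) (∧-intro (hyp (# 1)) (hyp (# 0)))))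
                   (∧-elim₂ (hyp (# 2))))))

+-monoʳ-≤ : ∀ {x y : Tm n s} (z : Tm n s) → Γ ⊩ x ≤' y → Γ ⊩ z `+ x ≤' z `+ y
+-monoʳ-≤ {x = x} {y} z p = ≤-respˡ-≐ (+-comm x z) (≤-respʳ-≐ (+-comm y z) (+-monoˡ-≤ z p))

+-mono-≤ : ∀ {x y u v : Tm n s} → Γ ⊩ x ≤' y → Γ ⊩ u ≤' v → Γ ⊩ x `+ u ≤' y `+ v
+-mono-≤ {y = y} {u} p q = ≤-trans (+-monoˡ-≤ u p) (+-monoʳ-≤ y q)

suc-+-suc : (x y : Tm n s) → Γ ⊩ (x `+ `1) `+ (y `+ `1) ≐ ((x `+ y) `+ `1) `+ `1
suc-+-suc x y = +-suc (x `+ `1) y ∙ +-congʳ `1 (suc-+ x y)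

+-mono-< : ∀ {x y u v : Tm n s} → Γ ⊩ x <' u → Γ ⊩ y <' v → Γ ⊩ x `+ y <' u `+ v
+-mono-< {x = x} {y} p q =
  +1≤⇒< (≤-trans (m≤m+n ((x `+ y) `+ `1) `1) (≤-respˡ-≐ (suc-+-suc x y) (+-mono-≤ (<⇒+1≤ p) (<⇒+1≤ q))))

two·≐+ : (x : Tm n s) → Γ ⊩ (`1 `+ `1) `· x ≐ x `+ x
two·≐+ x = suc-· `1 x ∙ +-congʳ x (·-comm `1 x ∙ ·-identityʳ x)

-- ⟨ x , y ⟩ = pronic (x + y) + 2 y
pronic : Tm n s → Tm n s
pronic t = t `· (t `+ `1)

pronic-suc : (t : Tm n s) → Γ ⊩ pronic (t `+ `1) ≐ pronic t `+ ((t `+ `1) `+ (t `+ `1))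
pronic-suc t = ·-suc (t `+ `1) (t `+ `1)
  ∙ +-congʳ (t `+ `1) (·-suc (t `+ `1) t ∙ +-congʳ (t `+ `1) (·-comm (t `+ `1) t))
  ∙ +-assoc (pronic t) (t `+ `1) (t `+ `1)

pronic-mono-≤ : ∀ {x y : Tm n s} → Γ ⊩ x ≤' y → Γ ⊩ pronic x ≤' pronic y
pronic-mono-≤ {x = x} {y} p = ≤-trans (·-monoʳ-≤ x (+-monoˡ-≤ `1 p))
  (≤-respˡ-≐ (·-comm (y `+ `1) x) (≤-respʳ-≐ (·-comm (y `+ `1) y) (·-monoʳ-≤ (y `+ `1) p)))

⟨⟩-<-of-+ : ∀ {a b c d : Tm n s} → Γ ⊩ a `+ b <' c `+ d → Γ ⊩ ⟨ a , b ⟩ <' ⟨ c , d ⟩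
⟨⟩-<-of-+ {Γ = Γ} {a} {b} {c} {d} p = +1≤⇒<
  (≤-respˡ-≐ (+-suc (pronic σ) ((`1 `+ `1) `· b))
    (≤-trans (≤-respʳ-≐ (≐-sym (pronic-suc σ)) (+-monoʳ-≤ (pronic σ) 2b+1≤2σ+2))
      (≤-trans (pronic-mono-≤ (<⇒+1≤ p)) (m≤m+n (pronic (c `+ d)) ((`1 `+ `1) `· d)))))
  where
    σ : Tm _ _
    σ = a `+ b
    b≤σ : Γ ⊩ b ≤' σ
    b≤σ = ≤-respʳ-≐ (+-comm b a) (m≤m+n b a)
    2b+1≤2σ+2 : Γ ⊩ (`1 `+ `1) `· b `+ `1 ≤' (σ `+ `1) `+ (σ `+ `1)
    2b+1≤2σ+2 = ≤-trans (+-monoˡ-≤ `1 (≤-respˡ-≐ (≐-sym (two·≐+ b)) (+-mono-≤ b≤σ b≤σ)))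
                        (≤-respʳ-≐ (≐-sym (suc-+-suc σ σ)) (m≤m+n ((σ `+ σ) `+ `1) `1))

⟨⟩-mono-< : ∀ {a b c d : Tm n s} → Γ ⊩ a <' c → Γ ⊩ b <' d → Γ ⊩ ⟨ a , b ⟩ <' ⟨ c , d ⟩
⟨⟩-mono-< p q = ⟨⟩-<-of-+ (+-mono-< p q)

≐-by-trichotomy : ∀ (x y : Tm n s) {P Q} → (x <' y) ∷ Γ ⊩ P <' Q → (y <' x) ∷ Γ ⊩ Q <' P →
  Γ ⊩ P ≐ Q → Γ ⊩ x ≐ y
≐-by-trichotomy x y lt gt P≐Q = by-cases (x ≐ y) (hyp (# 0))
  (∨-elim (≤-total x y)
    (contradiction (weaken (weaken P≐Q))
                   (∧-elim₂ (app (weaken (weaken (lam lt))) (∧-intro (hyp (# 0)) (hyp (# 1))))))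
    (contradiction (≐-sym (weaken (weaken P≐Q)))
                   (∧-elim₂ (app (weaken (weaken (lam gt))) (∧-intro (hyp (# 0)) (≢-sym (hyp (# 1))))))))

⟨⟩-injective : ∀ {a b c d : Tm n s} → Γ ⊩ ⟨ a , b ⟩ ≐ ⟨ c , d ⟩ → Γ ⊩ (a ≐ c) ∧' (b ≐ d)
⟨⟩-injective {Γ = Γ} {a} {b} {c} {d} p = ∧-intro a≐c b≐d
  where
    a+b≐c+d : Γ ⊩ a `+ b ≐ c `+ d
    a+b≐c+d = ≐-by-trichotomy (a `+ b) (c `+ d) (⟨⟩-<-of-+ (hyp (# 0))) (⟨⟩-<-of-+ (hyp (# 0))) p
    2b≐2d : Γ ⊩ (`1 `+ `1) `· b ≐ (`1 `+ `1) `· d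
    2b≐2d = +-cancelʳ (pronic (c `+ d))
      (+-comm _ (pronic (c `+ d)) ∙ +-congʳ _ (·-cong (≐-sym a+b≐c+d) (+-congʳ `1 (≐-sym a+b≐c+d)))
       ∙ p ∙ +-comm (pronic (c `+ d)) _)
    b≐d : Γ ⊩ b ≐ d
    b≐d = ≐-by-trichotomy b d (+-mono-< (hyp (# 0)) (hyp (# 0))) (+-mono-< (hyp (# 0)) (hyp (# 0)))
                          (≐-sym (two·≐+ b) ∙ 2b≐2d ∙ two·≐+ d)
    a≐c : Γ ⊩ a ≐ c
    a≐c = +-cancelʳ b (a+b≐c+d ∙ +-congˡ c (≐-sym b≐d))

-- Homomorphisms and their composition

∈⇒⊩ : ∀ {φ : Fm n s} → φ ∈ Γ → Γ ⊩ φ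
∈⇒⊩ (here refl) = hyp (# 0)
∈⇒⊩ (there p)   = weaken (∈⇒⊩ p)

Edges : ∀ {n s} (VA EA VB EB Z : Fin s) → Fm n s
Edges VA EA VB EB Z =
  ∀N ((v0 <' ∣ VA ∣) ⇒ ∀N ((v0 <' ∣ VA ∣) ⇒ ∀N ((v0 <' ∣ VB ∣) ⇒ ∀N ((v0 <' ∣ VB ∣) ⇒
    ((Ed EA v3 v2 ∧' ((⟨ v3 , v1 ⟩ ∈' Z) ∧' (⟨ v2 , v0 ⟩ ∈' Z))) ⇒ Ed EB v1 v0)))))

-- the formula under ∃Z in HOM
IsHom : ∀ {n s} (VA EA VB EB Z : Fin s) → Fm n s
IsHom VA EA VB EB Z = (∣ Z ∣ ≤' ⟨ ∣ VA ∣ , ∣ VB ∣ ⟩) ∧' MAP ∣ VA ∣ ∣ VB ∣ Z ∧' Edges VA EA VB EB Z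

module _ {VA EA VB EB Z : Fin s} (hom : Γ ⊩ IsHom VA EA VB EB Z) where

  hom-total : ∀ {x} → Γ ⊩ x <' ∣ VA ∣ → Γ ⊩ ∃N ((v0 <' ∣ VB ∣) ∧' (⟨ wkTmN x , v0 ⟩ ∈' Z))
  hom-total {x} = ∀<-elim (∧-elim₁ (∧-elim₁ (∧-elim₂ hom))) x

  hom-functional : ∀ {x y y'} → Γ ⊩ var x <' ∣ VA ∣ → Γ ⊩ var y <' ∣ VB ∣ → Γ ⊩ var y' <' ∣ VB ∣ →
    Γ ⊩ ⟨ var x , var y ⟩ ∈' Z → Γ ⊩ ⟨ var x , var y' ⟩ ∈' Z → Γ ⊩ var y ≐ var y'
  hom-functional {x} {y} {y'} px py py' zxy zxy' =
    app (∀<-elim (∀<-elim (∀<-elim (∧-elim₂ (∧-elim₁ (∧-elim₂ hom))) (var x) px) (var y) py) (var y') py')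
        (∧-intro zxy zxy')

  hom-edges : ∀ {x x' y y'} → Γ ⊩ var x <' ∣ VA ∣ → Γ ⊩ var x' <' ∣ VA ∣ → Γ ⊩ var y <' ∣ VB ∣ → Γ ⊩ var y' <' ∣ VB ∣ →
    Γ ⊩ Ed EA (var x) (var x') → Γ ⊩ ⟨ var x , var y ⟩ ∈' Z → Γ ⊩ ⟨ var x' , var y' ⟩ ∈' Z →
    Γ ⊩ Ed EB (var y) (var y')
  hom-edges {x} {x'} {y} {y'} px px' py py' e zxy zx'y' =
    app (∀<-elim (∀<-elim (∀<-elim (∀<-elim (∧-elim₂ (∧-elim₂ hom)) (var x) px) (var x') px') (var y) py) (var y') py')
        (∧-intro e (∧-intro zxy zx'y'))

-- Z(w) :⇔ ∃ i < |VA| ∃ k < |VC| (w = ⟨ i , k ⟩ ∧ ∃ j < |VB| (Z₁(i, j) ∧ Z₂(j, k)))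
Composite : ∀ {n s} (VA VB VC Z₁ Z₂ : Fin s) → Fm (suc n) s
Composite VA VB VC Z₁ Z₂ =
  ∃N ((v0 <' ∣ VA ∣) ∧' ∃N ((v0 <' ∣ VC ∣) ∧' ((v2 ≐ ⟨ v1 , v0 ⟩) ∧'
    ∃N ((v0 <' ∣ VB ∣) ∧' ((⟨ v2 , v0 ⟩ ∈' Z₁) ∧' (⟨ v0 , v1 ⟩ ∈' Z₂))))))

Composite-Σ₀ : ∀ {n s} (VA VB VC Z₁ Z₂ : Fin s) → IsΣB0 (Composite {n} VA VB VC Z₁ Z₂)
Composite-Σ₀ VA VB VC Z₁ Z₂ = ex< ∣ VA ∣ (ex< ∣ VC ∣ (and (eq _ _) (ex< ∣ VB ∣ (and (mem _ _) (mem _ _)))))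

IsComposite : ∀ {n s} (VA VB VC Z₁ Z₂ Z : Fin s) → Fm n s
IsComposite VA VB VC Z₁ Z₂ Z =
  (∣ Z ∣ ≤' ⟨ ∣ VA ∣ , ∣ VC ∣ ⟩) ∧' ∀N ((v0 <' ⟨ ∣ VA ∣ , ∣ VC ∣ ⟩) ⇒ ((v0 ∈' Z) ⇔ Composite VA VB VC Z₁ Z₂))

composite-exists : (VA VB VC Z₁ Z₂ : Fin s) →
  Γ ⊩ ∃S (IsComposite (suc VA) (suc VB) (suc VC) (suc Z₁) (suc Z₂) zero)
composite-exists VA VB VC Z₁ Z₂ =
  ∀-elim (∀S-elim (∀S-elim (∀S-elim (∀S-elim (∀S-elim (theorem (ax comprehension)) VC) VB) VA) Z₂) Z₁) ⟨ ∣ VA ∣ , ∣ VC ∣ ⟩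
  where φ : Fm 2 5
        φ = Composite (# 2) (# 3) (# 4) (# 0) (# 1)
        comprehension : V0 (close (COMP φ zero))
        comprehension = comp φ (Composite-Σ₀ (# 2) (# 3) (# 4) (# 0) (# 1)) zero

module Composition (VA EA VB EB VC EC Z₁ Z₂ Z : Fin s) where

  record Hyps (Γ : List (Fm n s)) : Set where
    constructor hyps
    field
      hom₁∈      : IsHom VA EA VB EB Z₁ ∈ Γ
      hom₂∈      : IsHom VB EB VC EC Z₂ ∈ Γ
      composite∈ : IsComposite VA VB VC Z₁ Z₂ Z ∈ Γ
  open Hyps

  _⁺ : ∀ {φ} → Hyps Γ → Hyps (φ ∷ Γ)
  H ⁺ = hyps (there (hom₁∈ H)) (there (hom₂∈ H)) (there (composite∈ H))

  _↑ : ∀ {φ} → Hyps Γ → Hyps (φ ∷ map wkN Γ)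
  H ↑ = hyps (there (∈-map⁺ wkN (hom₁∈ H))) (there (∈-map⁺ wkN (hom₂∈ H))) (there (∈-map⁺ wkN (composite∈ H)))

  hom₁ : Hyps Γ → Γ ⊩ IsHom VA EA VB EB Z₁
  hom₁ H = ∈⇒⊩ (hom₁∈ H)

  hom₂ : Hyps Γ → Γ ⊩ IsHom VB EB VC EC Z₂
  hom₂ H = ∈⇒⊩ (hom₂∈ H)

  composite : Hyps Γ → Γ ⊩ IsComposite VA VB VC Z₁ Z₂ Z
  composite H = ∈⇒⊩ (composite∈ H)

  composite-intro : Hyps Γ → ∀ {x y j} → Γ ⊩ var x <' ∣ VA ∣ → Γ ⊩ var y <' ∣ VC ∣ → Γ ⊩ var j <' ∣ VB ∣ →
    Γ ⊩ ⟨ var x , var j ⟩ ∈' Z₁ → Γ ⊩ ⟨ var j , var y ⟩ ∈' Z₂ → Γ ⊩ ⟨ var x , var y ⟩ ∈' Z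
  composite-intro H {x} {y} {j} px py pj z₁ z₂ =
    ⇔-elim₂ (∀<-elim (∧-elim₂ (composite H)) ⟨ var x , var y ⟩ (⟨⟩-mono-< px py))
      (∃-intro (var x) (∧-intro px (∃-intro (var y) (∧-intro py
        (∧-intro (≐-refl _) (∃-intro (var j) (∧-intro pj (∧-intro z₁ z₂))))))))

  composite-elim : Hyps Γ → ∀ {x y} → Γ ⊩ var x <' ∣ VA ∣ → Γ ⊩ var y <' ∣ VC ∣ → Γ ⊩ ⟨ var x , var y ⟩ ∈' Z →
    Γ ⊩ ∃N ((v0 <' ∣ VB ∣) ∧' ((⟨ var (suc x) , v0 ⟩ ∈' Z₁) ∧' (⟨ v0 , var (suc y) ⟩ ∈' Z₂)))
  composite-elim H {x} {y} px py z =
    ∃-elim (⇔-elim₁ (∀<-elim (∧-elim₂ (composite H)) ⟨ var x , var y ⟩ (⟨⟩-mono-< px py)) z)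
      (∃-elim (∧-elim₂ (hyp (# 0)))
        (cut (⟨⟩-injective (∧-elim₁ (∧-elim₂ (hyp (# 0)))))
          (∃-elim (∧-elim₂ (∧-elim₂ (hyp (# 1))))
            (∃-intro v0 (∧-intro (∧-elim₁ (hyp (# 0))) (∧-intro
              (∈-resp-≐ (⟨⟩-cong (≐-sym (∧-elim₁ (hyp (# 1)))) (≐-refl v0)) (∧-elim₁ (∧-elim₂ (hyp (# 0)))))
              (∈-resp-≐ (⟨⟩-cong (≐-refl v0) (≐-sym (∧-elim₂ (hyp (# 1))))) (∧-elim₂ (∧-elim₂ (hyp (# 0)))))))))))

  -- Hyps is threaded through the binders in continuation style, so that the extended
  -- context is determined by the rule rather than inferred from a weakened one.
  ∀⇒-introᴴ : ∀ {φ ψ} → Hyps Γ → (Hyps (φ ∷ map wkN Γ) → φ ∷ map wkN Γ ⊩ ψ) → Γ ⊩ ∀N (φ ⇒ ψ)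
  ∀⇒-introᴴ H k = ∀-intro (lam (k (H ↑)))

  ⇒-introᴴ : ∀ {φ ψ} → Hyps Γ → (Hyps (φ ∷ Γ) → φ ∷ Γ ⊩ ψ) → Γ ⊩ φ ⇒ ψ
  ⇒-introᴴ H k = lam (k (H ⁺))

  ∃-elimᴴ : ∀ {φ χ} → Hyps Γ → Γ ⊩ ∃N φ → (Hyps (φ ∷ map wkN Γ) → φ ∷ map wkN Γ ⊩ wkN χ) → Γ ⊩ χ
  ∃-elimᴴ H d k = ∃-elim d (k (H ↑))

  cutᴴ : ∀ {φ ψ} → Hyps Γ → Γ ⊩ φ → (Hyps (φ ∷ Γ) → φ ∷ Γ ⊩ ψ) → Γ ⊩ ψ
  cutᴴ H d k = cut d (k (H ⁺))

  composite-total : Hyps Γ → Γ ⊩ ∀N ((v0 <' ∣ VA ∣) ⇒ ∃N ((v0 <' ∣ VC ∣) ∧' (⟨ v1 , v0 ⟩ ∈' Z)))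
  composite-total H =
    ∀⇒-introᴴ H λ H →
    ∃-elimᴴ H (hom-total (hom₁ H) (hyp (# 0))) λ H →
    ∃-elimᴴ H (hom-total (hom₂ H) (∧-elim₁ (hyp (# 0)))) λ H →
    ∃-intro v0 (∧-intro (∧-elim₁ (hyp (# 0)))
      (composite-intro H (hyp (# 2)) (∧-elim₁ (hyp (# 0))) (∧-elim₁ (hyp (# 1))) (∧-elim₂ (hyp (# 1))) (∧-elim₂ (hyp (# 0)))))

  composite-functional : Hyps Γ → Γ ⊩ ∀N ((v0 <' ∣ VA ∣) ⇒ ∀N ((v0 <' ∣ VC ∣) ⇒ ∀N ((v0 <' ∣ VC ∣) ⇒
    (((⟨ v2 , v1 ⟩ ∈' Z) ∧' (⟨ v2 , v0 ⟩ ∈' Z)) ⇒ (v1 ≐ v0)))))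
  composite-functional H =
    ∀⇒-introᴴ H λ H → ∀⇒-introᴴ H λ H → ∀⇒-introᴴ H λ H → ⇒-introᴴ H λ H →
    ∃-elimᴴ H (composite-elim H (hyp (# 3)) (hyp (# 2)) (∧-elim₁ (hyp (# 0)))) λ H →
    ∃-elimᴴ H (composite-elim H (hyp (# 4)) (hyp (# 2)) (∧-elim₂ (hyp (# 1)))) λ H →
    cutᴴ H (hom-functional (hom₁ H) (hyp (# 5)) (∧-elim₁ (hyp (# 1))) (∧-elim₁ (hyp (# 0)))
                           (∧-elim₁ (∧-elim₂ (hyp (# 1)))) (∧-elim₁ (∧-elim₂ (hyp (# 0))))) λ H →
    hom-functional (hom₂ H) (∧-elim₁ (hyp (# 1))) (hyp (# 5)) (hyp (# 4))
      (∈-resp-≐ (⟨⟩-cong (hyp (# 0)) (≐-refl v3)) (∧-elim₂ (∧-elim₂ (hyp (# 2)))))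
      (∧-elim₂ (∧-elim₂ (hyp (# 1))))

  composite-edges : Hyps Γ → Γ ⊩ Edges VA EA VC EC Z
  composite-edges H =
    ∀⇒-introᴴ H λ H → ∀⇒-introᴴ H λ H → ∀⇒-introᴴ H λ H → ∀⇒-introᴴ H λ H → ⇒-introᴴ H λ H →
    ∃-elimᴴ H (composite-elim H (hyp (# 4)) (hyp (# 2)) (∧-elim₁ (∧-elim₂ (hyp (# 0))))) λ H →
    ∃-elimᴴ H (composite-elim H (hyp (# 4)) (hyp (# 2)) (∧-elim₂ (∧-elim₂ (hyp (# 1))))) λ H →
    hom-edges (hom₂ H) (∧-elim₁ (hyp (# 1))) (∧-elim₁ (hyp (# 0))) (hyp (# 4)) (hyp (# 3))
      (hom-edges (hom₁ H) (hyp (# 6)) (hyp (# 5)) (∧-elim₁ (hyp (# 1))) (∧-elim₁ (hyp (# 0)))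
                 (∧-elim₁ (hyp (# 2))) (∧-elim₁ (∧-elim₂ (hyp (# 1)))) (∧-elim₁ (∧-elim₂ (hyp (# 0)))))
      (∧-elim₂ (∧-elim₂ (hyp (# 1)))) (∧-elim₂ (∧-elim₂ (hyp (# 0))))

  composite-isHom : Hyps Γ → Γ ⊩ IsHom VA EA VC EC Z
  composite-isHom H =
    ∧-intro (∧-elim₁ (composite H)) (∧-intro (∧-intro (composite-total H) (composite-functional H)) (composite-edges H))

hom-compose : (VA EA VB EB VC EC : Fin s) → Γ ⊩ (HOM VA EA VB EB ∧' HOM VB EB VC EC) ⇒ HOM VA EA VC EC
hom-compose VA EA VB EB VC EC = lam
  (∃S-elim (∧-elim₁ (hyp (# 0)))
    (∃S-elim (∧-elim₂ (hyp (# 1)))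
      (∃S-elim (composite-exists (suc (suc VA)) (suc (suc VB)) (suc (suc VC)) (# 1) (# 0))
        (∃S-intro zero (composite-isHom (hyps (there (there (here refl))) (there (here refl)) (here refl)))))))
  where open Composition (suc (suc (suc VA))) (suc (suc (suc EA))) (suc (suc (suc VB))) (suc (suc (suc EB)))
                         (suc (suc (suc VC))) (suc (suc (suc EC))) (# 2) (# 1) zero

lemma3 : V0 ⊢ HOM-trans
lemma3 = ⊩⇒⊢ (∀S-intro (∀S-intro (∀S-intro (∀S-intro (∀S-intro (∀S-intro
  (lam (lam (lam (hom-compose (# 0) (# 1) (# 2) (# 3) (# 4) (# 5)))))))))))
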